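{- Let $n=2t$ be an even positive integer and $s$ a positive integer with $\gcd(s,t)=1$. Let $\{1,\xi\}$ be an $\mathbb{F}_{q^t}$-basis of $\mathbb{F}_{q^n}$ and $\epsilon=\xi^{ -1}$. Then the $\mathbb{F}_q$-linear set $L_p=\{\langle(x,p(x))\rangle_{\mathbb{F}_{q^n}}\colon x\in\mathbb{F}_{q^n}^*\}$ defined by \[p(x)=\mathrm{Tr}_{q^n/q^t}\Big(\frac{\epsilon^{q^t}}{\epsilon^{q^t}-\epsilon}x+\frac{1}{\epsilon^{q^{s+t}}-\epsilon^{q^s}}x^{q^s}\Big)\] has two points of weight $n/2$ and all the other points have weight one.
   Context: $\mathrm{Tr}_{q^n/q^t}(a)=a+a^{q^t}$. The weight of a point $\langle\mathbf v\rangle_{\mathbb{F}_{q^n}}$ in $L_p$ is $\dim_{\mathbb{F}_q}(U_p\cap\langle\mathbf v\rangle_{\mathbb{F}_{q^n}})$, where $U_p=\{(x,p(x))\colon x\in\mathbb{F}_{q^n}\}$. -}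

module Defs where

open import Level using (Level; _⊔_) renaming (suc to lsuc)
open import Data.Nat using (ℕ; zero; suc; _^_; _≥_)
open import Relation.Binary.PropositionalEquality using (_≡_)
open import Data.Nat.Primality using (Prime)
open import Data.Fin using (Fin)
open import Data.List using (length; filter; allFin)
open import Data.Product using (Σ; ∃; _×_; _,_)
open import Relation.Nullary using (¬_; Dec)
open import Relation.Binary using (Decidable)
open import Algebra.Bundles using (CommutativeRing)

IsPrimePower : ℕ → Set
IsPrimePower q = Σ ℕ λ r → Σ ℕ λ k → Prime r × k ≥ 1 × q ≡ r ^ k

-- A finite field: a commutative ring with 1 ≠ 0, multiplicative inverses of
-- nonzero elements (inverse is a total operation, value at 0 irrelevant),
-- decidable equality, and an explicit enumeration (bijection Fin size ≅ Carrier
-- up to ≈) giving its cardinality.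
record FiniteField (c ℓ : Level) : Set (lsuc (c ⊔ ℓ)) where
  field
    commRing : CommutativeRing c ℓ
  open CommutativeRing commRing public
  field
    _⁻¹      : Carrier → Carrier
    1≉0      : ¬ (1# ≈ 0#)
    inverseʳ : ∀ x → ¬ (x ≈ 0#) → (x * x ⁻¹) ≈ 1#
    _≟_      : Decidable _≈_
    size     : ℕ
    enum     : Fin size → Carrier
    enum-surj : ∀ x → ∃ λ i → enum i ≈ x
    enum-inj  : ∀ i j → enum i ≈ enum j → i ≡ j

module _ {c ℓ : Level} (F : FiniteField c ℓ) where
  open FiniteField F

  pow : Carrier → ℕ → Carrier
  pow x zero    = 1#
  pow x (suc m) = x * pow x m

  _/_ : Carrier → Carrier → Carrier
  a / b = a * (b ⁻¹)

  count : {P : Carrier → Set ℓ} → (∀ x → Dec (P x)) → ℕ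
  count P? = length (filter (λ i → P? (enum i)) (allFin size))

  InSubfield : ℕ → Carrier → Set ℓ
  InSubfield Q a = pow a Q ≈ a

  IsBasis1ξ : ℕ → Carrier → Set (c ⊔ ℓ)
  IsBasis1ξ Q ξ =
      (∀ z → Σ Carrier λ a → Σ Carrier λ b →
         InSubfield Q a × InSubfield Q b × (z ≈ (a + (b * ξ))))
    × (∀ a b → InSubfield Q a → InSubfield Q b →
         (a + (b * ξ)) ≈ 0# → (a ≈ 0#) × (b ≈ 0#))

  -- relative trace Tr_{q^n/q^t}(a) = a + a^{q^t}   (n = 2t, Q = q^t)
  Tr : ℕ → Carrier → Carrier
  Tr Q a = a + pow a Q

  pPoly : (Q S : ℕ) → (ε : Carrier) → Carrier → Carrier
  pPoly Q S ε x =
    Tr Q (((pow ε Q / (pow ε Q - ε)) * x)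
          + ((1# / (pow (pow ε Q) S - pow ε S)) * pow x S))

  module _ (p : Carrier → Carrier) where
    -- ⟨(x,p(x))⟩ = ⟨(y,p(y))⟩ for nonzero x, y  ⇔  x p(y) - y p(x) = 0
    SamePoint : Carrier → Carrier → Set ℓ
    SamePoint x y = (x * p y) ≈ (y * p x)

    -- the F_q-subspace U_p ∩ ⟨(x,p(x))⟩ = {(y,p(y)) : SamePoint x y}
    -- has dimension w over F_q, i.e. has exactly q^w elements
    HasWeight : (q : ℕ) → Carrier → ℕ → Set
    HasWeight q x w = count (λ y → (x * p y) ≟ (y * p x)) ≡ q ^ w

{-# OPTIONS --safe #-}
module Submission where

-- Write σ x = x ^ (q ^ t), τ x = x ^ (q ^ s) and ε = ξ⁻¹.  As |F| is a power of the prime r,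
-- r · 1 = 0 in F (translation by 1 permutes F, so |F| · 1 = 0), and r divides r C k for
-- 0 < k < r; hence σ and τ are field endomorphisms.  σ is an involution with fixed field
-- K = F_{q^t}, and every x is uniquely α x + β x ε with α x, β x ∈ K.
-- Unfolding p gives p x = α x − τ (β x): p maps onto K, fixes K pointwise and kills 1 + ε,
-- so the points of 1 and 1 + ε have weight t, as |K| = q^t and |ker p| = |F| / |K|.
-- For any other x, comparing K-coordinates in x p(y) = y p(x) forces y = μ x with μ ∈ K
-- and τ μ = μ, hence μ ^ q = μ because gcd(s, t) = 1: the weight is one.  The counts
-- |{z ∣ z ^ Q = z}| = Q (for Q = q and Q = q^t) come from |F| = |ker ℘| · |im ℘| for the
-- additive ℘ z = z ^ Q − z: ℘ has degree Q, and its image lies among the roots of the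
-- trace polynomial Σ_{i<n} w ^ (Q ^ i), of degree Q^(n−1), where |F| = Q^n.

open import Defs
open import Level using (Level; _⊔_)
open import Function using (_∘_; id)
open import Data.Bool using (Bool; true; false)
open import Data.Nat as ℕ using (ℕ; zero; suc; _≤_; _<_; _≥_; z≤n; s≤s)
import Data.Nat.Properties as ℕ
open import Data.Nat.Divisibility using (_∣_; divides; ∣⇒≤)
open import Data.Nat.Primality using (Prime; euclidsLemma; prime⇒nonTrivial)
open import Data.Nat.Combinatorics using (_C_; nCn≡1; nC1≡n; nCk+nC[k+1]≡[n+1]C[k+1])
open import Data.Nat.GCD using (gcd; gcd-GCD; module Bézout)
open import Data.Integer as ℤ using (ℤ; +_; -[1+_]; _⊖_)
import Data.Integer.Properties as ℤ
open import Data.Sign as Sign using (Sign)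
open import Data.Fin as Fin using (Fin; zero; suc; fromℕ; inject₁)
import Data.Fin.Properties as Fin
open import Data.Fin.Permutation using (Permutation; _⟨$⟩ʳ_)
import Data.Vec.Functional as Vector
open import Function.Bundles using (mk↔ₛ′)
open import Data.List using (length; filter; tabulate)
open import Data.Maybe using (Maybe; just; nothing)
open import Data.Product using (Σ; ∃; _×_; _,_; proj₁; proj₂)
open import Data.Sum using (_⊎_; inj₁; inj₂)
import Data.Sum
open import Relation.Nullary using (¬_; yes; no; does; contradiction)
open import Relation.Unary using (Pred; Decidable; _∈_; _∉_; _⊆_; _∪_; _≐_; Empty)
open import Relation.Binary.Definitions using (_Respects_)
open import Relation.Binary.PropositionalEquality as ≡ using (_≡_)
open import Algebra.Bundles using (CommutativeRing)
import Algebra.Solver.Ring.AlmostCommutativeRing as ACR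
import Algebra.Properties.CommutativeMonoid.Sum as CommutativeMonoidSum
import Algebra.Properties.CommutativeSemiring.Binomial as Binomial

module ℕSum = CommutativeMonoidSum ℕ.+-0-commutativeMonoid
open ℕSum using (sum)

private
  variable
    ℓ₀ ℓ₁ ℓ₂ ℓ₃ : Level
    n : ℕ

indicator : Bool → ℕ
indicator true  = 1
indicator false = 0

countFin : {P : Pred (Fin n) ℓ₁} → Decidable P → ℕ
countFin P? = sum λ i → indicator (does (P? i))

countFin-mono : {P : Pred (Fin n) ℓ₁} {Q : Pred (Fin n) ℓ₂} (P? : Decidable P) (Q? : Decidable Q) →
                P ⊆ Q → countFin P? ≤ countFin Q?
countFin-mono {n = zero}  P? Q? P⊆Q = z≤n
countFin-mono {n = suc n} P? Q? P⊆Q with P? zero | Q? zero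
... | no _  | _     = ℕ.≤-trans (countFin-mono (P? ∘ suc) (Q? ∘ suc) P⊆Q) (ℕ.m≤n+m _ _)
... | yes _ | yes _ = s≤s (countFin-mono (P? ∘ suc) (Q? ∘ suc) P⊆Q)
... | yes p | no ¬q = contradiction (P⊆Q p) ¬q

countFin-cong : {P : Pred (Fin n) ℓ₁} {Q : Pred (Fin n) ℓ₂} (P? : Decidable P) (Q? : Decidable Q) →
                P ≐ Q → countFin P? ≡ countFin Q?
countFin-cong P? Q? (P⊆Q , Q⊆P) = ℕ.≤-antisym (countFin-mono P? Q? P⊆Q) (countFin-mono Q? P? Q⊆P)

countFin-∪ : {P : Pred (Fin n) ℓ₁} {Q : Pred (Fin n) ℓ₂} {R : Pred (Fin n) ℓ₃}
             (P? : Decidable P) (Q? : Decidable Q) (R? : Decidable R) →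
             P ⊆ Q ∪ R → countFin P? ≤ countFin Q? ℕ.+ countFin R?
countFin-∪ {n = zero}  P? Q? R? P⊆Q∪R = z≤n
countFin-∪ {n = suc n} P? Q? R? P⊆Q∪R with P? zero | Q? zero | R? zero
                                        | countFin-∪ (P? ∘ suc) (Q? ∘ suc) (R? ∘ suc) P⊆Q∪R
... | no _  | Q₀    | R₀    | IH = ℕ.≤-trans IH (ℕ.+-mono-≤ (ℕ.m≤n+m _ (indicator (does Q₀))) (ℕ.m≤n+m _ (indicator (does R₀))))
... | yes _ | yes _ | R₀    | IH = s≤s (ℕ.≤-trans IH (ℕ.+-monoʳ-≤ (countFin (Q? ∘ suc)) (ℕ.m≤n+m _ (indicator (does R₀)))))
... | yes _ | no _  | yes _ | IH = ℕ.≤-trans (s≤s IH) (ℕ.≤-reflexive (≡.sym (ℕ.+-suc _ _)))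
... | yes p | no ¬q | no ¬r | IH with P⊆Q∪R p
...   | inj₁ q = contradiction q ¬q
...   | inj₂ r = contradiction r ¬r

countFin-empty : {P : Pred (Fin n) ℓ₁} (P? : Decidable P) → Empty P → countFin P? ≡ 0
countFin-empty {n = zero}  P? ∅ = ≡.refl
countFin-empty {n = suc n} P? ∅ with P? zero
... | yes p = contradiction p (∅ zero)
... | no _  = countFin-empty (P? ∘ suc) (∅ ∘ suc)

countFin-singleton : (j : Fin n) → countFin (Fin._≟ j) ≡ 1
countFin-singleton {suc n} zero    = ≡.cong suc (countFin-empty {n = n} (λ i → suc i Fin.≟ zero) λ _ ())
countFin-singleton {suc n} (suc j) = ≡.trans (countFin-cong (λ i → suc i Fin.≟ suc j) (Fin._≟ j)
                                (Fin.suc-injective , ≡.cong suc))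
                             (countFin-singleton j)

countFin-permute : {P : Pred (Fin n) ℓ₁} (P? : Decidable P) (π : Permutation n n) →
                   countFin (P? ∘ (π ⟨$⟩ʳ_)) ≡ countFin P?
countFin-permute P? π = ≡.sym (ℕSum.sum-permute (λ i → indicator (does (P? i))) π)

length-filter-tabulate : {A : Set ℓ₀} {P : Pred A ℓ₁} (P? : Decidable P) (g : Fin n → A) →
                         length (filter P? (tabulate g)) ≡ countFin (P? ∘ g)
length-filter-tabulate {n = zero}  P? g = ≡.refl
length-filter-tabulate {n = suc n} P? g with does (P? (g zero))
... | true  = ≡.cong suc (length-filter-tabulate P? (g ∘ suc))
... | false = length-filter-tabulate P? (g ∘ suc)

module IntegerCoefficientSolver {c ℓ} (R : CommutativeRing c ℓ) where
  open CommutativeRing R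
  open import Algebra.Properties.Ring ring using (-‿involutive; -0#≈0#; -‿distribˡ-*; -‿+-comm)
  open import Algebra.Properties.Semiring.Mult.TCOptimised semiring using (×-homo-+; ×1-homo-*) renaming (_×_ to _·_)
  open import Relation.Binary.Reasoning.Setoid setoid

  -- The optimised _·_ makes ⟦ + 1 ⟧ℤ reduce to 1#, so that the constant :1# normalises.
  ⟦_⟧ℤ : ℤ → Carrier
  ⟦ + n      ⟧ℤ = n · 1#
  ⟦ -[1+ n ] ⟧ℤ = - (suc n · 1#)

  [1+n]·1#≈1#+n·1# : ∀ n → suc n · 1# ≈ 1# + n · 1#
  [1+n]·1#≈1#+n·1# = ×-homo-+ 1# 1

  ⊖-homo : ∀ m n → ⟦ m ⊖ n ⟧ℤ ≈ m · 1# - n · 1#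
  ⊖-homo m       zero    = sym (trans (+-congˡ -0#≈0#) (+-identityʳ _))
  ⊖-homo zero    (suc n) = sym (+-identityˡ _)
  ⊖-homo (suc m) (suc n) = begin
    ⟦ suc m ⊖ suc n ⟧ℤ            ≡⟨ ≡.cong ⟦_⟧ℤ (ℤ.[1+m]⊖[1+n]≡m⊖n m n) ⟩
    ⟦ m ⊖ n ⟧ℤ                    ≈⟨ ⊖-homo m n ⟩
    M - N                         ≈⟨ M-N≈[1+M]-[1+N] ⟩
    (1# + M) - (1# + N)           ≈⟨ +-cong ([1+n]·1#≈1#+n·1# m) (-‿cong ([1+n]·1#≈1#+n·1# n)) ⟨
    suc m · 1# - suc n · 1#       ∎
    where
      M = m · 1#
      N = n · 1#
      M-N≈[1+M]-[1+N] : M - N ≈ (1# + M) - (1# + N)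
      M-N≈[1+M]-[1+N] = begin
        M - N                         ≈⟨ +-congʳ (sym (+-identityˡ M)) ⟩
        (0# + M) - N                  ≈⟨ +-congʳ (+-congʳ (sym (-‿inverseʳ 1#))) ⟩
        ((1# - 1#) + M) - N           ≈⟨ +-congʳ (trans (+-assoc _ _ _) (trans (+-congˡ (+-comm _ _)) (sym (+-assoc _ _ _)))) ⟩
        ((1# + M) - 1#) - N           ≈⟨ +-assoc _ _ _ ⟩
        (1# + M) + (- 1# - N)         ≈⟨ +-congˡ (-‿+-comm 1# N) ⟩
        (1# + M) - (1# + N)           ∎

  signed : Sign → Carrier
  signed s = ⟦ s ℤ.◃ 1 ⟧ℤ

  ◃-homo : ∀ s k → ⟦ s ℤ.◃ k ⟧ℤ ≈ signed s * k · 1#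
  ◃-homo s        zero    = sym (zeroʳ _)
  ◃-homo Sign.+   (suc k) = sym (*-identityˡ _)
  ◃-homo Sign.-   (suc k) = sym (trans (sym (-‿distribˡ-* _ _)) (-‿cong (*-identityˡ _)))

  sign-homo : ∀ s t → signed (s Sign.* t) ≈ signed s * signed t
  sign-homo Sign.+ Sign.+ = sym (*-identityˡ _)
  sign-homo Sign.+ Sign.- = sym (*-identityˡ _)
  sign-homo Sign.- Sign.+ = sym (*-identityʳ _)
  sign-homo Sign.- Sign.- = sym (trans (sym (-‿distribˡ-* _ _)) (trans (-‿cong (*-identityˡ _)) (-‿involutive 1#)))

  ∣∣-◃ : ∀ i → ⟦ i ⟧ℤ ≈ signed (ℤ.sign i) * ℤ.∣ i ∣ · 1#
  ∣∣-◃ i = trans (reflexive (≡.cong ⟦_⟧ℤ (≡.sym (ℤ.◃-inverse i)))) (◃-homo (ℤ.sign i) ℤ.∣ i ∣)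

  +-homo : ∀ i j → ⟦ i ℤ.+ j ⟧ℤ ≈ ⟦ i ⟧ℤ + ⟦ j ⟧ℤ
  +-homo (+ m)    (+ n)    = ×-homo-+ 1# m n
  +-homo (+ m)    -[1+ n ] = ⊖-homo m (suc n)
  +-homo -[1+ m ] (+ n)    = trans (⊖-homo n (suc m)) (+-comm _ _)
  +-homo -[1+ m ] -[1+ n ] = begin
    - (suc (suc (m ℕ.+ n)) · 1#)            ≡⟨ ≡.cong (λ k → - (suc k · 1#)) (ℕ.+-suc m n) ⟨
    - ((suc m ℕ.+ suc n) · 1#)              ≈⟨ -‿cong (×-homo-+ 1# (suc m) (suc n)) ⟩
    - (suc m · 1# + suc n · 1#)             ≈⟨ -‿+-comm _ _ ⟨
    - (suc m · 1#) + - (suc n · 1#)         ∎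

  *-homo : ∀ i j → ⟦ i ℤ.* j ⟧ℤ ≈ ⟦ i ⟧ℤ * ⟦ j ⟧ℤ
  *-homo i j = begin
    ⟦ (ℤ.sign i Sign.* ℤ.sign j) ℤ.◃ (ℤ.∣ i ∣ ℕ.* ℤ.∣ j ∣) ⟧ℤ
      ≈⟨ ◃-homo (ℤ.sign i Sign.* ℤ.sign j) (ℤ.∣ i ∣ ℕ.* ℤ.∣ j ∣) ⟩
    signed (ℤ.sign i Sign.* ℤ.sign j) * (ℤ.∣ i ∣ ℕ.* ℤ.∣ j ∣) · 1#
      ≈⟨ *-cong (sign-homo (ℤ.sign i) (ℤ.sign j)) (×1-homo-* ℤ.∣ i ∣ ℤ.∣ j ∣) ⟩
    (signed (ℤ.sign i) * signed (ℤ.sign j)) * (ℤ.∣ i ∣ · 1# * ℤ.∣ j ∣ · 1#)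
      ≈⟨ interchange ⟩
    (signed (ℤ.sign i) * ℤ.∣ i ∣ · 1#) * (signed (ℤ.sign j) * ℤ.∣ j ∣ · 1#)
      ≈⟨ *-cong (∣∣-◃ i) (∣∣-◃ j) ⟨
    ⟦ i ⟧ℤ * ⟦ j ⟧ℤ ∎
    where
      interchange : ∀ {a b x y} → (a * b) * (x * y) ≈ (a * x) * (b * y)
      interchange = trans (*-assoc _ _ _) (trans (*-congˡ (trans (sym (*-assoc _ _ _))
                      (trans (*-congʳ (*-comm _ _)) (*-assoc _ _ _)))) (sym (*-assoc _ _ _)))

  -‿homo : ∀ i → ⟦ ℤ.- i ⟧ℤ ≈ - ⟦ i ⟧ℤ
  -‿homo (+ zero)  = sym -0#≈0#
  -‿homo (+ suc n) = refl
  -‿homo -[1+ n ]  = sym (-‿involutive _)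

  private
    ring≈ : ACR.AlmostCommutativeRing c ℓ
    ring≈ = ACR.fromCommutativeRing R

    ⟦⟧-homomorphism : ℤ.+-*-rawRing ACR.-Raw-AlmostCommutative⟶ ring≈
    ⟦⟧-homomorphism = record
      { ⟦_⟧ = ⟦_⟧ℤ ; +-homo = +-homo ; *-homo = *-homo ; -‿homo = -‿homo
      ; 0-homo = refl ; 1-homo = refl }

    ≡-weaklyDecidable : ∀ i j → Maybe (⟦ i ⟧ℤ ≈ ⟦ j ⟧ℤ)
    ≡-weaklyDecidable i j with i ℤ.≟ j
    ... | yes ≡.refl = just refl
    ... | no _       = nothing

  open import Algebra.Solver.Ring ℤ.+-*-rawRing ring≈ ⟦⟧-homomorphism ≡-weaklyDecidable public

  :1# : ∀ {n} → Polynomial n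
  :1# = con (+ 1)

module FieldProperties {c ℓ} (F : FiniteField c ℓ) where
  open FiniteField F public hiding (zero)
  open IntegerCoefficientSolver commRing public using (solve; _:+_; _:*_; :-_; _:-_; _:=_; :1#)
  open import Algebra.Properties.Ring ring public using (-0#≈0#; -‿involutive; -‿distribˡ-*; -‿distribʳ-*)
  open import Relation.Binary.Reasoning.Setoid setoid

  x-y+y≈x : ∀ x y → (x - y) + y ≈ x
  x-y+y≈x = solve 2 (λ x y → (x :- y) :+ y := x) refl

  x+y-y≈x : ∀ x y → (x + y) - y ≈ x
  x+y-y≈x = solve 2 (λ x y → (x :+ y) :- y := x) refl

  x-y≈0⇒x≈y : ∀ {x y} → x - y ≈ 0# → x ≈ y
  x-y≈0⇒x≈y {x} {y} x-y≈0 = begin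
    x             ≈⟨ x-y+y≈x x y ⟨
    (x - y) + y   ≈⟨ +-congʳ x-y≈0 ⟩
    0# + y        ≈⟨ +-identityˡ y ⟩
    y             ∎

  x≈y⇒x-y≈0 : ∀ {x y} → x ≈ y → x - y ≈ 0#
  x≈y⇒x-y≈0 {y = y} x≈y = trans (+-congʳ x≈y) (-‿inverseʳ y)

  ⁻¹-inverseˡ : ∀ x → x ≉ 0# → x ⁻¹ * x ≈ 1#
  ⁻¹-inverseˡ x x≉0 = trans (*-comm _ _) (inverseʳ x x≉0)

  x*y≈0⇒x≈0⊎y≈0 : ∀ {x y} → x * y ≈ 0# → x ≈ 0# ⊎ y ≈ 0#
  x*y≈0⇒x≈0⊎y≈0 {x} {y} xy≈0 with x ≟ 0#
  ... | yes x≈0 = inj₁ x≈0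
  ... | no  x≉0 = inj₂ (begin
    y                ≈⟨ *-identityˡ y ⟨
    1# * y           ≈⟨ *-congʳ (⁻¹-inverseˡ x x≉0) ⟨
    (x ⁻¹ * x) * y   ≈⟨ *-assoc _ _ _ ⟩
    x ⁻¹ * (x * y)   ≈⟨ *-congˡ xy≈0 ⟩
    x ⁻¹ * 0#        ≈⟨ zeroʳ _ ⟩
    0#               ∎)

  x*y≈0∧x≉0⇒y≈0 : ∀ {x y} → x * y ≈ 0# → x ≉ 0# → y ≈ 0#
  x*y≈0∧x≉0⇒y≈0 xy≈0 x≉0 with x*y≈0⇒x≈0⊎y≈0 xy≈0
  ... | inj₁ x≈0 = contradiction x≈0 x≉0
  ... | inj₂ y≈0 = y≈0

  x*y≈0∧y≉0⇒x≈0 : ∀ {x y} → x * y ≈ 0# → y ≉ 0# → x ≈ 0#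
  x*y≈0∧y≉0⇒x≈0 xy≈0 y≉0 = x*y≈0∧x≉0⇒y≈0 (trans (*-comm _ _) xy≈0) y≉0

  *-cancelˡ : ∀ {a x y} → a ≉ 0# → a * x ≈ a * y → x ≈ y
  *-cancelˡ {a} {x} {y} a≉0 ax≈ay = x-y≈0⇒x≈y (x*y≈0∧x≉0⇒y≈0 a[x-y]≈0 a≉0)
    where a[x-y]≈0 : a * (x - y) ≈ 0#
          a[x-y]≈0 = trans (solve 3 (λ a x y → a :* (x :- y) := a :* x :- a :* y) refl a x y) (x≈y⇒x-y≈0 ax≈ay)

  ⁻¹-unique : ∀ {x y} → x ≉ 0# → x * y ≈ 1# → y ≈ x ⁻¹
  ⁻¹-unique x≉0 xy≈1 = *-cancelˡ x≉0 (trans xy≈1 (sym (inverseʳ _ x≉0)))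

  ⁻¹-≉0 : ∀ {x} → x ≉ 0# → x ⁻¹ ≉ 0#
  ⁻¹-≉0 {x} x≉0 x⁻¹≈0 = 1≉0 (trans (sym (inverseʳ x x≉0)) (trans (*-congˡ x⁻¹≈0) (zeroʳ x)))

  x*y⁻¹*y≈x : ∀ {y} → y ≉ 0# → ∀ x → x * y ⁻¹ * y ≈ x
  x*y⁻¹*y≈x {y} y≉0 x = trans (*-assoc _ _ _) (trans (*-congˡ (⁻¹-inverseˡ y y≉0)) (*-identityʳ x))

  x*y*y⁻¹≈x : ∀ {y} → y ≉ 0# → ∀ x → x * y * y ⁻¹ ≈ x
  x*y*y⁻¹≈x {y} y≉0 x = trans (*-assoc _ _ _) (trans (*-congˡ (inverseʳ y y≉0)) (*-identityʳ x))

  infixr 8 _^_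
  _^_ : Carrier → ℕ → Carrier
  _^_ = pow F

  ^-cong : ∀ {x y} n → x ≈ y → x ^ n ≈ y ^ n
  ^-cong zero    x≈y = refl
  ^-cong (suc n) x≈y = *-cong x≈y (^-cong n x≈y)

  ^-homo-* : ∀ x m n → x ^ (m ℕ.+ n) ≈ x ^ m * x ^ n
  ^-homo-* x zero    n = sym (*-identityˡ _)
  ^-homo-* x (suc m) n = trans (*-congˡ (^-homo-* x m n)) (sym (*-assoc _ _ _))

  ^-distrib-* : ∀ x y n → (x * y) ^ n ≈ x ^ n * y ^ n
  ^-distrib-* x y zero    = sym (*-identityˡ _)
  ^-distrib-* x y (suc n) = trans (*-congˡ (^-distrib-* x y n))
    (solve 4 (λ x y a b → x :* y :* (a :* b) := x :* a :* (y :* b)) refl x y (x ^ n) (y ^ n))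

  1#^n≈1# : ∀ n → 1# ^ n ≈ 1#
  1#^n≈1# zero    = refl
  1#^n≈1# (suc n) = trans (*-identityˡ _) (1#^n≈1# n)

  ^-identityʳ : ∀ x → x ^ 1 ≈ x
  ^-identityʳ = *-identityʳ

  ^-assocʳ : ∀ x m n → (x ^ m) ^ n ≈ x ^ (m ℕ.* n)
  ^-assocʳ x zero    n = 1#^n≈1# n
  ^-assocʳ x (suc m) n = begin
    (x * x ^ m) ^ n          ≈⟨ ^-distrib-* x (x ^ m) n ⟩
    x ^ n * (x ^ m) ^ n      ≈⟨ *-congˡ (^-assocʳ x m n) ⟩
    x ^ n * x ^ (m ℕ.* n)    ≈⟨ ^-homo-* x n (m ℕ.* n) ⟨
    x ^ (n ℕ.+ m ℕ.* n)      ∎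

  ^-comm : ∀ x m n → (x ^ m) ^ n ≈ (x ^ n) ^ m
  ^-comm x m n = begin
    (x ^ m) ^ n       ≈⟨ ^-assocʳ x m n ⟩
    x ^ (m ℕ.* n)     ≡⟨ ≡.cong (x ^_) (ℕ.*-comm m n) ⟩
    x ^ (n ℕ.* m)     ≈⟨ ^-assocʳ x n m ⟨
    (x ^ n) ^ m       ∎

  x^n≈0⇒x≈0 : ∀ {x} n → x ^ n ≈ 0# → x ≈ 0#
  x^n≈0⇒x≈0 zero    1≈0 = contradiction 1≈0 1≉0
  x^n≈0⇒x≈0 (suc n) x^[1+n]≈0 with x*y≈0⇒x≈0⊎y≈0 x^[1+n]≈0
  ... | inj₁ x≈0   = x≈0
  ... | inj₂ x^n≈0 = x^n≈0⇒x≈0 n x^n≈0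

  x≉0⇒x^n≉0 : ∀ {x} n → x ≉ 0# → x ^ n ≉ 0#
  x≉0⇒x^n≉0 n x≉0 = x≉0 ∘ x^n≈0⇒x≈0 n

  open import Algebra.Properties.Semiring.Mult semiring public using (×1-homo-*) renaming (_×_ to _·_)

  ·1#-homo-^ : ∀ m n → (m ℕ.^ n) · 1# ≈ (m · 1#) ^ n
  ·1#-homo-^ m zero    = +-identityʳ 1#
  ·1#-homo-^ m (suc n) = trans (×1-homo-* m (m ℕ.^ n)) (*-congˡ (·1#-homo-^ m n))

  ^-fixed-iterate : ∀ {x} E → x ^ E ≈ x → ∀ n → x ^ (E ℕ.^ n) ≈ x
  ^-fixed-iterate {x} E x^E≈x zero    = ^-identityʳ x
  ^-fixed-iterate {x} E x^E≈x (suc n) = begin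
    x ^ (E ℕ.* E ℕ.^ n)       ≈⟨ ^-assocʳ x E (E ℕ.^ n) ⟨
    (x ^ E) ^ (E ℕ.^ n)       ≈⟨ ^-cong (E ℕ.^ n) x^E≈x ⟩
    x ^ (E ℕ.^ n)             ≈⟨ ^-fixed-iterate E x^E≈x n ⟩
    x                         ∎

  ^-fixed-Bézout : ∀ q {a b m n x} → 1 ℕ.+ n ℕ.* b ≡ m ℕ.* a →
                   x ^ (q ℕ.^ a) ≈ x → x ^ (q ℕ.^ b) ≈ x → x ^ q ≈ x
  ^-fixed-Bézout q {a} {b} {m} {n} {x} 1+nb≡ma fixed-a fixed-b = begin
    x ^ q                              ≈⟨ ^-cong q (^-fixed-iterate (q ℕ.^ b) fixed-b n) ⟨
    (x ^ ((q ℕ.^ b) ℕ.^ n)) ^ q        ≈⟨ ^-assocʳ x ((q ℕ.^ b) ℕ.^ n) q ⟩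
    x ^ ((q ℕ.^ b) ℕ.^ n ℕ.* q)        ≡⟨ ≡.cong (x ^_) exponents ⟩
    x ^ ((q ℕ.^ a) ℕ.^ m)              ≈⟨ ^-fixed-iterate (q ℕ.^ a) fixed-a m ⟩
    x                                  ∎
    where
      exponents : (q ℕ.^ b) ℕ.^ n ℕ.* q ≡ (q ℕ.^ a) ℕ.^ m
      exponents = ≡.trans (ℕ.*-comm _ q) (≡.trans (≡.cong (q ℕ.*_) (ℕ.^-*-assoc q b n))
                  (≡.trans (≡.cong (q ℕ.^_) (≡.trans (≡.cong suc (ℕ.*-comm b n))
                  (≡.trans 1+nb≡ma (ℕ.*-comm m a)))) (≡.sym (ℕ.^-*-assoc q a m))))

  ^-fixed-gcd : ∀ q {a b x} → gcd a b ≡ 1 → x ^ (q ℕ.^ a) ≈ x → x ^ (q ℕ.^ b) ≈ x → x ^ q ≈ x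
  ^-fixed-gcd q {a} {b} gcd≡1 fixed-a fixed-b
    with ≡.subst (λ g → Bézout.Identity g a b) gcd≡1 (Bézout.identity (gcd-GCD a b))
  ... | Bézout.+- m n 1+nb≡ma = ^-fixed-Bézout q {a} {b} {m} {n} 1+nb≡ma fixed-a fixed-b
  ... | Bézout.-+ m n 1+ma≡nb = ^-fixed-Bézout q {b} {a} {n} {m} 1+ma≡nb fixed-b fixed-a

CharacteristicDivides : ∀ {c ℓ} → FiniteField c ℓ → ℕ → Set ℓ
CharacteristicDivides F r = r · 1# ≈ 0#
  where open FieldProperties F

module FieldCounting {c ℓ} (F : FiniteField c ℓ) where
  open FieldProperties F

  index : Carrier → Fin size
  index x = proj₁ (enum-surj x)

  enum-index : ∀ x → enum (index x) ≈ x
  enum-index x = proj₂ (enum-surj x)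

  infix 10 #_
  #_ : {P : Pred Carrier ℓ₁} → Decidable P → ℕ
  # P? = countFin (P? ∘ enum)

  count≡# : {P : Pred Carrier ℓ} (P? : Decidable P) → count F P? ≡ # P?
  count≡# P? = length-filter-tabulate (P? ∘ enum) id

  module _ {P : Pred Carrier ℓ₁} {Q : Pred Carrier ℓ₂} (P? : Decidable P) (Q? : Decidable Q) where

    #-mono : P ⊆ Q → # P? ≤ # Q?
    #-mono P⊆Q = countFin-mono (P? ∘ enum) (Q? ∘ enum) P⊆Q

    #-cong : P ≐ Q → # P? ≡ # Q?
    #-cong (P⊆Q , Q⊆P) = countFin-cong (P? ∘ enum) (Q? ∘ enum) (P⊆Q , Q⊆P)

    #-∪ : {R : Pred Carrier ℓ₃} (R? : Decidable R) → P ⊆ Q ∪ R → # P? ≤ # Q? ℕ.+ # R?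
    #-∪ R? P⊆Q∪R = countFin-∪ (P? ∘ enum) (Q? ∘ enum) (R? ∘ enum) P⊆Q∪R

  #-empty : {P : Pred Carrier ℓ₁} (P? : Decidable P) → Empty P → # P? ≡ 0
  #-empty P? ∅ = countFin-empty (P? ∘ enum) (∅ ∘ enum)

  #-singleton : ∀ a → # (_≟ a) ≡ 1
  #-singleton a = ≡.trans (countFin-cong (λ i → enum i ≟ a) (Fin._≟ index a) (to-index , from-index))
                  (countFin-singleton (index a))
    where
      to-index : ∀ {i} → enum i ≈ a → i ≡ index a
      to-index e = enum-inj _ _ (trans e (sym (enum-index a)))
      from-index : ∀ {i} → i ≡ index a → enum i ≈ a
      from-index ≡.refl = enum-index a

  module Bijection (h h⁻¹ : Carrier → Carrier)
           (h-cong : ∀ {x y} → x ≈ y → h x ≈ h y) (h⁻¹-cong : ∀ {x y} → x ≈ y → h⁻¹ x ≈ h⁻¹ y)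
           (h∘h⁻¹ : ∀ x → h (h⁻¹ x) ≈ x) (h⁻¹∘h : ∀ x → h⁻¹ (h x) ≈ x) where

    permutation : Permutation size size
    permutation = mk↔ₛ′ (λ i → index (h (enum i))) (λ j → index (h⁻¹ (enum j)))
      (λ j → enum-inj _ _ (trans (enum-index _) (trans (h-cong (enum-index _)) (h∘h⁻¹ _))))
      (λ i → enum-inj _ _ (trans (enum-index _) (trans (h⁻¹-cong (enum-index _)) (h⁻¹∘h _))))

    enum-permutation : ∀ i → enum (permutation ⟨$⟩ʳ i) ≈ h (enum i)
    enum-permutation i = enum-index _

    #-bijection : {P : Pred Carrier ℓ₁} (P? : Decidable P) → P Respects _≈_ → # (P? ∘ h) ≡ # P?
    #-bijection P? resp =
      ≡.trans (countFin-cong (P? ∘ h ∘ enum) (P? ∘ enum ∘ (permutation ⟨$⟩ʳ_))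
                             (resp (sym (enum-permutation _)) , resp (enum-permutation _)))
              (countFin-permute (P? ∘ enum) permutation)

  module Translation (a : Carrier) =
    Bijection (_+ a) (_- a) +-congʳ +-congʳ (λ x → x-y+y≈x x a) (λ x → x+y-y≈x x a)

  module Scaling {a : Carrier} (a≉0 : a ≉ 0#) =
    Bijection (_* a) (_* a ⁻¹) *-congʳ *-congʳ (x*y⁻¹*y≈x a≉0) (x*y*y⁻¹≈x a≉0)

  #-translate : {P : Pred Carrier ℓ₁} (P? : Decidable P) → P Respects _≈_ →
                ∀ a → # (λ x → P? (x + a)) ≡ # P?
  #-translate P? resp a = Translation.#-bijection a P? resp

  #-scale : {P : Pred Carrier ℓ₁} (P? : Decidable P) → P Respects _≈_ →
            ∀ {a} → a ≉ 0# → # (λ x → P? (x * a)) ≡ # P?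
  #-scale P? resp a≉0 = Scaling.#-bijection a≉0 P? resp

[1+k]*[1+n]C[1+k]≡[1+n]*nCk : ∀ n k → suc k ℕ.* (suc n C suc k) ≡ suc n ℕ.* (n C k)
[1+k]*[1+n]C[1+k]≡[1+n]*nCk zero    zero    = ≡.refl
[1+k]*[1+n]C[1+k]≡[1+n]*nCk zero    (suc k) = ℕ.*-zeroʳ (suc (suc k))
[1+k]*[1+n]C[1+k]≡[1+n]*nCk (suc n) zero    =
  ≡.trans (ℕ.*-identityˡ _) (≡.trans (nC1≡n (suc (suc n))) (≡.sym (ℕ.*-identityʳ _)))
[1+k]*[1+n]C[1+k]≡[1+n]*nCk (suc n) (suc k) = begin
  suc (suc k) ℕ.* (suc (suc n) C suc (suc k))           ≡⟨ ≡.cong (suc (suc k) ℕ.*_) (nCk+nC[k+1]≡[n+1]C[k+1] (suc n) (suc k)) ⟨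
  suc (suc k) ℕ.* (A ℕ.+ B)                             ≡⟨ ℕ.*-distribˡ-+ (suc (suc k)) A B ⟩
  (A ℕ.+ suc k ℕ.* A) ℕ.+ suc (suc k) ℕ.* B             ≡⟨ ≡.cong₂ (λ u v → (A ℕ.+ u) ℕ.+ v)
                                                             ([1+k]*[1+n]C[1+k]≡[1+n]*nCk n k)
                                                             ([1+k]*[1+n]C[1+k]≡[1+n]*nCk n (suc k)) ⟩
  (A ℕ.+ suc n ℕ.* (n C k)) ℕ.+ suc n ℕ.* (n C suc k)   ≡⟨ ℕ.+-assoc A _ _ ⟩
  A ℕ.+ (suc n ℕ.* (n C k) ℕ.+ suc n ℕ.* (n C suc k))   ≡⟨ ≡.cong (A ℕ.+_) (ℕ.*-distribˡ-+ (suc n) (n C k) (n C suc k)) ⟨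
  A ℕ.+ suc n ℕ.* (n C k ℕ.+ n C suc k)                 ≡⟨ ≡.cong (λ u → A ℕ.+ suc n ℕ.* u) (nCk+nC[k+1]≡[n+1]C[k+1] n k) ⟩
  suc (suc n) ℕ.* A                                     ∎
  where
    open ≡.≡-Reasoning
    A = suc n C suc k
    B = suc n C suc (suc k)

prime∣pCk : ∀ {p k} → Prime p → 0 < k → k < p → p ∣ p C k
prime∣pCk {suc n} {suc k} p-prime _ k<p
  with euclidsLemma (suc k) (suc n C suc k) p-prime
         (divides (n C k) (≡.trans ([1+k]*[1+n]C[1+k]≡[1+n]*nCk n k) (ℕ.*-comm (suc n) (n C k))))
... | inj₁ p∣k = contradiction (∣⇒≤ p∣k) (ℕ.<⇒≱ k<p)
... | inj₂ p∣C = p∣C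

module Characteristic {c ℓ} (F : FiniteField c ℓ) where
  open FieldProperties F
  open import Relation.Binary.Reasoning.Setoid setoid
  open FieldCounting F
  private module ∑ = CommutativeMonoidSum +-commutativeMonoid

  size·1#≈0# : size · 1# ≈ 0#
  size·1#≈0# = begin
    size · 1#                          ≈⟨ solve 2 (λ a b → b := (a :+ b) :- a) refl ∑enum (size · 1#) ⟩
    (∑enum + size · 1#) - ∑enum        ≈⟨ +-congʳ ∑enum≈∑enum+size·1# ⟨
    ∑enum - ∑enum                      ≈⟨ -‿inverseʳ ∑enum ⟩
    0#                                 ∎
    where
      ∑enum = ∑.sum enum
      π : Permutation size size
      π = Translation.permutation 1#
      ∑enum≈∑enum+size·1# : ∑enum ≈ ∑enum + size · 1#
      ∑enum≈∑enum+size·1# = begin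
        ∑enum                              ≈⟨ ∑.sum-permute enum π ⟩
        ∑.sum (enum ∘ (π ⟨$⟩ʳ_))           ≈⟨ ∑.sum-cong-≋ (Translation.enum-permutation 1#) ⟩
        ∑.sum (λ i → enum i + 1#)          ≈⟨ ∑.∑-distrib-+ enum (λ _ → 1#) ⟩
        ∑enum + ∑.sum {size} (λ _ → 1#)    ≈⟨ +-congˡ (∑.sum-replicate size) ⟩
        ∑enum + size · 1#                  ∎

  size≡r^m⇒r·1#≈0# : ∀ {r m} → size ≡ r ℕ.^ m → r · 1# ≈ 0#
  size≡r^m⇒r·1#≈0# {r} {m} size≡r^m = x^n≈0⇒x≈0 m (begin
    (r · 1#) ^ m     ≈⟨ ·1#-homo-^ r m ⟨
    (r ℕ.^ m) · 1#   ≡⟨ ≡.cong (_· 1#) size≡r^m ⟨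
    size · 1#        ≈⟨ size·1#≈0# ⟩
    0#               ∎)

module Frobenius {c ℓ} (F : FiniteField c ℓ)
                 {r} (r-prime : Prime r) (r·1#≈0# : CharacteristicDivides F r) where
  open FieldProperties F
  open import Relation.Binary.Reasoning.Setoid setoid
  open import Algebra.Properties.Semiring.Exp semiring using () renaming (_^_ to _^ᴿ_)
  open import Algebra.Properties.Semiring.Mult semiring using (×-assoc-*; ×-congʳ)
  open Binomial commutativeSemiring using (binomialTerm; binomialExpansion) renaming (theorem to binomial-theorem)
  private module ∑ = CommutativeMonoidSum +-commutativeMonoid

  ^≈^ᴿ : ∀ x n → x ^ n ≈ x ^ᴿ n
  ^≈^ᴿ x zero    = refl
  ^≈^ᴿ x (suc n) = *-congˡ (^≈^ᴿ x n)

  r∣m⇒m·x≈0# : ∀ {m} → r ∣ m → ∀ x → m · x ≈ 0#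
  r∣m⇒m·x≈0# {m} (divides d ≡.refl) x = begin
    (d ℕ.* r) · x                ≈⟨ ×-congʳ (d ℕ.* r) (*-identityˡ x) ⟨
    (d ℕ.* r) · (1# * x)         ≈⟨ ×-assoc-* (d ℕ.* r) 1# x ⟨
    ((d ℕ.* r) · 1#) * x         ≈⟨ *-congʳ (trans (×1-homo-* d r) (*-congˡ r·1#≈0#)) ⟩
    ((d · 1#) * 0#) * x          ≈⟨ trans (*-congʳ (zeroʳ _)) (zeroˡ x) ⟩
    0#                           ∎

  private
    ^p-homo-+ : ∀ {p} → Prime p → p ≡ r → ∀ x y → (x + y) ^ p ≈ x ^ p + y ^ p
    ^p-homo-+ {suc (suc m)} _ ≡.refl x y = begin
      (x + y) ^ r                                 ≈⟨ ^≈^ᴿ (x + y) r ⟩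
      (x + y) ^ᴿ r                                ≈⟨ binomial-theorem r x y ⟩
      T zero + ∑.sum (T ∘ suc)                    ≈⟨ +-congˡ (∑.sum-init-last (T ∘ suc)) ⟩
      T zero + (∑.sum (Vector.init (T ∘ suc)) + Vector.last (T ∘ suc))
                                                  ≈⟨ +-cong first (+-cong middle last) ⟩
      y ^ r + (0# + x ^ r)                        ≈⟨ trans (+-congˡ (+-identityˡ _)) (+-comm _ _) ⟩
      x ^ r + y ^ r                               ∎
      where
        T = binomialTerm x y r
        first : T zero ≈ y ^ r
        first = begin
          1 · (1# * y ^ᴿ r)       ≈⟨ +-identityʳ _ ⟩
          1# * y ^ᴿ r             ≈⟨ *-identityˡ _ ⟩
          y ^ᴿ r                  ≈⟨ ^≈^ᴿ y r ⟨
          y ^ r                   ∎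
        middle : ∑.sum (Vector.init (T ∘ suc)) ≈ 0#
        middle = trans (∑.sum-cong-≋ λ i → r∣m⇒m·x≈0# (prime∣pCk r-prime (s≤s z≤n) (s≤s (Fin.inject₁ℕ< i)))
                                                     (Binomial.binomial commutativeSemiring x y r (suc (inject₁ i))))
                       (∑.sum-replicate-zero (suc m))
        last : Vector.last (T ∘ suc) ≈ x ^ r
        last = begin
          T (fromℕ r)                                   ≡⟨ ≡.cong (λ k → (r C k) · (x ^ᴿ k * y ^ᴿ (r ℕ.∸ k))) (Fin.toℕ-fromℕ r) ⟩
          (r C r) · (x ^ᴿ r * y ^ᴿ (r ℕ.∸ r))           ≡⟨ ≡.cong₂ (λ k l → k · (x ^ᴿ r * y ^ᴿ l)) (nCn≡1 r) (ℕ.n∸n≡0 r) ⟩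
          1 · (x ^ᴿ r * 1#)                             ≈⟨ trans (+-identityʳ _) (*-identityʳ _) ⟩
          x ^ᴿ r                                        ≈⟨ ^≈^ᴿ x r ⟨
          x ^ r                                         ∎

  ^r-homo-+ : ∀ x y → (x + y) ^ r ≈ x ^ r + y ^ r
  ^r-homo-+ = ^p-homo-+ r-prime ≡.refl

  ^r^m-homo-+ : ∀ m x y → (x + y) ^ (r ℕ.^ m) ≈ x ^ (r ℕ.^ m) + y ^ (r ℕ.^ m)
  ^r^m-homo-+ zero    x y = trans (^-identityʳ _) (sym (+-cong (^-identityʳ x) (^-identityʳ y)))
  ^r^m-homo-+ (suc m) x y = begin
    (x + y) ^ (r ℕ.* r ℕ.^ m)                     ≈⟨ ^-assocʳ (x + y) r (r ℕ.^ m) ⟨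
    ((x + y) ^ r) ^ (r ℕ.^ m)                     ≈⟨ ^-cong (r ℕ.^ m) (^r-homo-+ x y) ⟩
    (x ^ r + y ^ r) ^ (r ℕ.^ m)                   ≈⟨ ^r^m-homo-+ m _ _ ⟩
    (x ^ r) ^ (r ℕ.^ m) + (y ^ r) ^ (r ℕ.^ m)     ≈⟨ +-cong (^-assocʳ x r _) (^-assocʳ y r _) ⟩
    x ^ (r ℕ.* r ℕ.^ m) + y ^ (r ℕ.* r ℕ.^ m)     ∎

module Polynomials {c ℓ} (F : FiniteField c ℓ) where
  open FieldProperties F
  open import Relation.Binary.Reasoning.Setoid setoid
  open FieldCounting F

  data Polynomial≤ : ℕ → (Carrier → Carrier) → Set (c ⊔ ℓ) where
    constant : ∀ {f} b → (∀ x → f x ≈ b) → Polynomial≤ 0 f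
    horner   : ∀ {d f} g b → Polynomial≤ d g → (∀ x → f x ≈ x * g x + b) → Polynomial≤ (suc d) f

  data Monic : ℕ → (Carrier → Carrier) → Set (c ⊔ ℓ) where
    one    : ∀ {f} → (∀ x → f x ≈ 1#) → Monic 0 f
    horner : ∀ {d f} g b → Monic d g → (∀ x → f x ≈ x * g x + b) → Monic (suc d) f

  private
    variable
      d e : ℕ
      f g : Carrier → Carrier

  Monic⇒Polynomial≤ : Monic d f → Polynomial≤ d f
  Monic⇒Polynomial≤ (one f≈1)           = constant 1# f≈1
  Monic⇒Polynomial≤ (horner g b mg f≈) = horner g b (Monic⇒Polynomial≤ mg) f≈

  Polynomial≤-cong : Polynomial≤ d f → ∀ {x y} → x ≈ y → f x ≈ f y
  Polynomial≤-cong (constant b f≈b)       x≈y = trans (f≈b _) (sym (f≈b _))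
  Polynomial≤-cong (horner g b pg f≈) x≈y =
    trans (f≈ _) (trans (+-congʳ (*-cong x≈y (Polynomial≤-cong pg x≈y))) (sym (f≈ _)))

  Monic-cong : Monic d f → ∀ {x y} → x ≈ y → f x ≈ f y
  Monic-cong = Polynomial≤-cong ∘ Monic⇒Polynomial≤

  Monic-resp : (∀ x → g x ≈ f x) → Monic d f → Monic d g
  Monic-resp g≈f (one f≈1)              = one (λ x → trans (g≈f x) (f≈1 x))
  Monic-resp g≈f (horner h b mh f≈)    = horner h b mh (λ x → trans (g≈f x) (f≈ x))

  Monic-+ : Monic d f → Polynomial≤ e g → e < d → Monic d (λ x → f x + g x)
  Monic-+ (horner h b mh f≈) (constant b′ g≈b′) _ =
    horner h (b + b′) mh (λ x → trans (+-cong (f≈ x) (g≈b′ x)) (+-assoc _ _ _))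
  Monic-+ (horner h b mh f≈) (horner h′ b′ ph′ g≈) (s≤s e<d) =
    horner (λ x → h x + h′ x) (b + b′) (Monic-+ mh ph′ e<d) λ x →
      trans (+-cong (f≈ x) (g≈ x))
            (solve 5 (λ x u v b b′ → (x :* u :+ b) :+ (x :* v :+ b′) := x :* (u :+ v) :+ (b :+ b′))
                     refl x (h x) (h′ x) b b′)

  Monic-^ : ∀ n → Monic n (_^ n)
  Monic-^ zero    = one (λ _ → refl)
  Monic-^ (suc n) = horner (_^ n) 0# (Monic-^ n) (λ _ → sym (+-identityʳ _))

  factor-theorem : Monic (suc d) f → ∀ a →
                   ∃ λ h → Monic d h × (∀ x → f x - f a ≈ (x - a) * h x)
  factor-theorem {f = f} (horner g b (one g≈1) f≈) a = (λ _ → 1#) , one (λ _ → refl) , λ x → begin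
    f x - f a                            ≈⟨ +-cong (f≈ x) (-‿cong (f≈ a)) ⟩
    (x * g x + b) - (a * g a + b)        ≈⟨ +-cong (+-congʳ (*-congˡ (g≈1 x))) (-‿cong (+-congʳ (*-congˡ (g≈1 a)))) ⟩
    (x * 1# + b) - (a * 1# + b)          ≈⟨ solve 4 (λ x a b o → (x :* o :+ b) :- (a :* o :+ b) := (x :- a) :* o) refl x a b 1# ⟩
    (x - a) * 1#                         ∎
  factor-theorem {f = f} (horner g b mg@(horner _ _ _ _) f≈) a with factor-theorem mg a
  ... | h , mh , g-ga≈ = (λ x → x * h x + g a) , horner h (g a) mh (λ _ → refl) , λ x → begin
    f x - f a                              ≈⟨ +-cong (f≈ x) (-‿cong (f≈ a)) ⟩
    (x * g x + b) - (a * g a + b)          ≈⟨ solve 5 (λ x a u v b → (x :* u :+ b) :- (a :* v :+ b) := x :* (u :- v) :+ (x :- a) :* v)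
                                                      refl x a (g x) (g a) b ⟩
    x * (g x - g a) + (x - a) * g a        ≈⟨ +-congʳ (*-congˡ (g-ga≈ x)) ⟩
    x * ((x - a) * h x) + (x - a) * g a    ≈⟨ solve 4 (λ x a u v → x :* ((x :- a) :* u) :+ (x :- a) :* v := (x :- a) :* (x :* u :+ v))
                                                      refl x a (h x) (g a) ⟩
    (x - a) * (x * h x + g a)              ∎

  #roots≤degree : Monic d f → # (λ x → f x ≟ 0#) ≤ d
  #roots≤degree {f = f} (one f≈1) =
    ℕ.≤-reflexive (#-empty (λ x → f x ≟ 0#) (λ x fx≈0 → 1≉0 (trans (sym (f≈1 x)) fx≈0)))
  #roots≤degree {suc d} {f} mf with Fin.any? (λ i → f (enum i) ≟ 0#)
  ... | no no-root = ℕ.≤-trans (ℕ.≤-reflexive (#-empty (λ x → f x ≟ 0#) λ x fx≈0 →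
                       no-root (index x , trans (Monic-cong mf (enum-index x)) fx≈0))) z≤n
  ... | yes (i , fa≈0) with factor-theorem mf (enum i)
  ...   | h , mh , f-fa≈ = ℕ.≤-trans
    (#-∪ (λ x → f x ≟ 0#) (_≟ a) (λ x → h x ≟ 0#) root-or-root)
    (ℕ.≤-trans (ℕ.≤-reflexive (≡.cong (ℕ._+ # (λ x → h x ≟ 0#)) (#-singleton a))) (s≤s (#roots≤degree mh)))
    where
      a = enum i
      root-or-root : ∀ {x} → f x ≈ 0# → x ≈ a ⊎ h x ≈ 0#
      root-or-root {x} fx≈0 = Data.Sum.map₁ x-y≈0⇒x≈y (x*y≈0⇒x≈0⊎y≈0
        (trans (sym (f-fa≈ x)) (trans (+-cong fx≈0 (-‿cong fa≈0)) (-‿inverseʳ 0#))))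

module AdditiveMaps {c ℓ} (F : FiniteField c ℓ) where
  open FieldProperties F
  open FieldCounting F

  record IsAdditive (f : Carrier → Carrier) : Set (c ⊔ ℓ) where
    field
      cong   : ∀ {x y} → x ≈ y → f x ≈ f y
      +-homo : ∀ x y → f (x + y) ≈ f x + f y

  module _ {f : Carrier → Carrier} (f-additive : IsAdditive f) where
    open IsAdditive f-additive

    #fibre≡#kernel : ∀ {x₀ y} → f x₀ ≈ y → # (λ x → f x ≟ y) ≡ # (λ x → f x ≟ 0#)
    #fibre≡#kernel {x₀} {y} fx₀≈y = ≡.trans
      (≡.sym (#-translate (λ x → f x ≟ y) (λ x≈x′ fx≈y → trans (cong (sym x≈x′)) fx≈y) x₀))
      (#-cong (λ x → f (x + x₀) ≟ y) (λ x → f x ≟ 0#)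
        ( (λ {x} fx+x₀≈y → trans (sym (x+y-y≈x (f x) y)) (x≈y⇒x-y≈0 (trans (+-congˡ (sym fx₀≈y)) (trans (sym (+-homo x x₀)) fx+x₀≈y))))
        , (λ {x} fx≈0 → trans (+-homo x x₀) (trans (+-cong fx≈0 fx₀≈y) (+-identityˡ y)))))

    size≡#kernel*#image : {I : Pred Carrier ℓ₁} (I? : Decidable I) → I Respects _≈_ →
                          (∀ x → I (f x)) → (∀ y → I y → ∃ λ x → f x ≈ y) →
                          size ≡ # (λ x → f x ≟ 0#) ℕ.* # I?
    size≡#kernel*#image I? I-resp I∋f I⊆image = begin
      size                                                    ≡⟨ sum-ones size ⟨
      ∑ (λ _ → 1)                                             ≡⟨ ℕSum.sum-cong-≋ (λ i → #-singleton′ (f (enum i))) ⟨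
      ∑ (λ i → # (λ y → f (enum i) ≟ y))                      ≡⟨ ℕSum.∑-comm (λ i j → indicator (does (f (enum i) ≟ enum j))) ⟩
      ∑ (λ j → # (λ x → f x ≟ enum j))                        ≡⟨ ℕSum.sum-cong-≋ #fibre ⟩
      ∑ (λ j → indicator (does (I? (enum j))) ℕ.* K)          ≡⟨ *-distribʳ-sum K (λ j → indicator (does (I? (enum j)))) ⟨
      # I? ℕ.* K                                              ≡⟨ ℕ.*-comm (# I?) K ⟩
      K ℕ.* # I?                                              ∎
      where
        open ≡.≡-Reasoning
        open import Algebra.Properties.Semiring.Sum ℕ.+-*-semiring using (*-distribʳ-sum)
        ∑ = ℕSum.sum {size}
        K = # (λ x → f x ≟ 0#)
        sum-ones : ∀ n → ℕSum.sum {n} (λ _ → 1) ≡ n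
        sum-ones zero    = ≡.refl
        sum-ones (suc n) = ≡.cong suc (sum-ones n)
        #-singleton′ : ∀ a → # (λ y → a ≟ y) ≡ 1
        #-singleton′ a = ≡.trans (#-cong (λ y → a ≟ y) (_≟ a) (sym , sym)) (#-singleton a)
        #fibre : ∀ j → # (λ x → f x ≟ enum j) ≡ indicator (does (I? (enum j))) ℕ.* K
        #fibre j with I? (enum j)
        ... | no ¬I = #-empty (λ x → f x ≟ enum j) (λ x fx≈ → ¬I (I-resp fx≈ (I∋f x)))
        ... | yes I∋ = ≡.trans (#fibre≡#kernel (proj₂ (I⊆image _ I∋))) (≡.sym (ℕ.+-identityʳ K))

module FrobeniusEndomorphism {c ℓ} (F : FiniteField c ℓ)
                             {r} (r-prime : Prime r) (r·1#≈0# : CharacteristicDivides F r)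
                             {E m} (E≡r^m : E ≡ r ℕ.^ m) where
  open FieldProperties F
  open Frobenius F r-prime r·1#≈0#

  φ : Carrier → Carrier
  φ x = x ^ E

  cong : ∀ {x y} → x ≈ y → φ x ≈ φ y
  cong = ^-cong E

  +-homo : ∀ x y → φ (x + y) ≈ φ x + φ y
  +-homo x y rewrite E≡r^m = ^r^m-homo-+ m x y

  *-homo : ∀ x y → φ (x * y) ≈ φ x * φ y
  *-homo x y = ^-distrib-* x y E

  0#-homo : φ 0# ≈ 0#
  0#-homo = trans (solve 1 (λ a → a := (a :+ a) :- a) refl (φ 0#))
                  (trans (+-congʳ (trans (sym (+-homo 0# 0#)) (cong (+-identityʳ 0#)))) (-‿inverseʳ _))

  1#-homo : φ 1# ≈ 1#
  1#-homo = 1#^n≈1# E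

  -‿homo : ∀ x → φ (- x) ≈ - φ x
  -‿homo x = begin
    φ (- x)                    ≈⟨ solve 2 (λ a b → a := (b :+ a) :- b) refl (φ (- x)) (φ x) ⟩
    (φ x + φ (- x)) - φ x      ≈⟨ +-congʳ (+-homo x (- x)) ⟨
    φ (x - x) - φ x            ≈⟨ +-congʳ (trans (cong (-‿inverseʳ x)) 0#-homo) ⟩
    0# - φ x                   ≈⟨ +-identityˡ _ ⟩
    - φ x                      ∎
    where open import Relation.Binary.Reasoning.Setoid setoid

  minus-homo : ∀ x y → φ (x - y) ≈ φ x - φ y
  minus-homo x y = trans (+-homo x (- y)) (+-congˡ (-‿homo y))

  ≉0-homo : ∀ {x} → x ≉ 0# → φ x ≉ 0#
  ≉0-homo = x≉0⇒x^n≉0 E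

  ⁻¹-homo : ∀ {x} → x ≉ 0# → φ (x ⁻¹) ≈ φ x ⁻¹
  ⁻¹-homo {x} x≉0 = ⁻¹-unique (≉0-homo x≉0) (trans (sym (*-homo x (x ⁻¹))) (trans (cong (inverseʳ x x≉0)) 1#-homo))

q≡r^k⇒q^n≡r^[k*n] : ∀ {q r k} → q ≡ r ℕ.^ k → ∀ n → q ℕ.^ n ≡ r ℕ.^ (k ℕ.* n)
q≡r^k⇒q^n≡r^[k*n] {r = r} {k} ≡.refl n = ℕ.^-*-assoc r k n

module FrobeniusFixedPoints {c ℓ} (F : FiniteField c ℓ)
                            {r} (r-prime : Prime r) (r·1#≈0# : CharacteristicDivides F r)
                            {q k} (q≡r^k : q ≡ r ℕ.^ k) (1<q : 1 < q) where
  open FieldProperties F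
  open FieldCounting F
  open Polynomials F
  open AdditiveMaps F

  module φ n = FrobeniusEndomorphism F r-prime r·1#≈0# {m = k ℕ.* n} (q≡r^k⇒q^n≡r^[k*n] {r = r} {k} q≡r^k n)

  ℘ : Carrier → Carrier
  ℘ z = z ^ q - z

  ℘-additive : IsAdditive ℘
  ℘-additive = record
    { cong   = λ x≈y → +-cong (^-cong q x≈y) (-‿cong x≈y)
    ; +-homo = λ x y → trans (+-congʳ (φ₁.+-homo x y))
        (solve 4 (λ a b x y → (a :+ b) :- (x :+ y) := (a :- x) :+ (b :- y)) refl (x ^ q) (y ^ q) x y)
    }
    where module φ₁ = FrobeniusEndomorphism F r-prime r·1#≈0# {m = k} q≡r^k

  ℘-monic : Monic q ℘
  ℘-monic = Monic-+ (Monic-^ q) (horner (λ _ → - 1#) 0# (constant (- 1#) (λ _ → refl)) minus-x) 1<q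
    where minus-x : ∀ x → - x ≈ x * - 1# + 0#
          minus-x x = sym (trans (+-identityʳ _) (trans (sym (-‿distribʳ-* x 1#)) (-‿cong (*-identityʳ x))))

  tr : ℕ → Carrier → Carrier
  tr zero    w = 0#
  tr (suc n) w = tr n w + w ^ (q ℕ.^ n)

  tr-monic : ∀ n → Monic (q ℕ.^ n) (tr (suc n))
  tr-monic zero    = Monic-resp (λ w → +-identityˡ _) (Monic-^ 1)
  tr-monic (suc n) = Monic-resp (λ w → +-comm _ _)
    (Monic-+ (Monic-^ (q ℕ.^ suc n)) (Monic⇒Polynomial≤ (tr-monic n)) (ℕ.^-monoʳ-< q 1<q (ℕ.n<1+n n)))

  tr∘℘ : ∀ n z → tr n (℘ z) ≈ z ^ (q ℕ.^ n) - z
  tr∘℘ zero    z = sym (trans (+-congʳ (^-identityʳ z)) (-‿inverseʳ z))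
  tr∘℘ (suc n) z = begin
    tr n (℘ z) + ℘ z ^ (q ℕ.^ n)                                  ≈⟨ +-cong (tr∘℘ n z) (φ.minus-homo n (z ^ q) z) ⟩
    (z ^ (q ℕ.^ n) - z) + ((z ^ q) ^ (q ℕ.^ n) - z ^ (q ℕ.^ n))   ≈⟨ +-congˡ (+-congʳ (^-assocʳ z q (q ℕ.^ n))) ⟩
    (z ^ (q ℕ.^ n) - z) + (z ^ (q ℕ.^ suc n) - z ^ (q ℕ.^ n))     ≈⟨ solve 3 (λ a z b → (a :- z) :+ (b :- a) := b :- z)
                                                                           refl (z ^ (q ℕ.^ n)) z (z ^ (q ℕ.^ suc n)) ⟩
    z ^ (q ℕ.^ suc n) - z                                         ∎
    where open import Relation.Binary.Reasoning.Setoid setoid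

  Image : Pred Carrier ℓ
  Image y = ∃ λ i → ℘ (enum i) ≈ y

  Image? : Decidable Image
  Image? y = Fin.any? (λ i → ℘ (enum i) ≟ y)

  #fixed≡#kernel : # (λ z → (z ^ q) ≟ z) ≡ # (λ z → ℘ z ≟ 0#)
  #fixed≡#kernel = #-cong (λ z → (z ^ q) ≟ z) (λ z → ℘ z ≟ 0#) (x≈y⇒x-y≈0 , x-y≈0⇒x≈y)

  #fixed≤q : # (λ z → (z ^ q) ≟ z) ≤ q
  #fixed≤q = ℕ.≤-trans (ℕ.≤-reflexive #fixed≡#kernel) (#roots≤degree ℘-monic)

  #image≤q^n : ∀ n → (∀ z → z ^ (q ℕ.^ suc n) ≈ z) → # Image? ≤ q ℕ.^ n
  #image≤q^n n z^q^[1+n]≈z = ℕ.≤-trans (#-mono Image? (λ w → tr (suc n) w ≟ 0#) image⊆roots) (#roots≤degree (tr-monic n))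
    where
      image⊆roots : ∀ {y} → Image y → tr (suc n) y ≈ 0#
      image⊆roots (i , ℘eᵢ≈y) = trans (Monic-cong (tr-monic n) (sym ℘eᵢ≈y))
                                (trans (tr∘℘ (suc n) (enum i)) (x≈y⇒x-y≈0 (z^q^[1+n]≈z (enum i))))

  size≡#ker℘*#im℘ : size ≡ # (λ z → ℘ z ≟ 0#) ℕ.* # Image?
  size≡#ker℘*#im℘ = size≡#kernel*#image ℘-additive Image? (λ x≈y (i , e) → i , trans e x≈y)
    (λ x → index x , IsAdditive.cong ℘-additive (enum-index x)) (λ y (i , e) → enum i , e)

  #fixed≡q : ∀ n → size ≡ q ℕ.^ suc n → (∀ z → z ^ (q ℕ.^ suc n) ≈ z) → # (λ z → (z ^ q) ≟ z) ≡ q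
  #fixed≡q n size≡q^[1+n] z^q^[1+n]≈z = ℕ.≤-antisym #fixed≤q (ℕ.*-cancelʳ-≤ q _ (q ℕ.^ n) (begin
    q ℕ.* q ℕ.^ n                         ≡⟨ size≡q^[1+n] ⟨
    size                                  ≡⟨ size≡#ker℘*#im℘ ⟩
    # (λ z → ℘ z ≟ 0#) ℕ.* # Image?       ≤⟨ ℕ.*-monoʳ-≤ (# (λ z → ℘ z ≟ 0#)) (#image≤q^n n z^q^[1+n]≈z) ⟩
    # (λ z → ℘ z ≟ 0#) ℕ.* q ℕ.^ n        ≡⟨ ≡.cong (ℕ._* q ℕ.^ n) #fixed≡#kernel ⟨
    # (λ z → (z ^ q) ≟ z) ℕ.* q ℕ.^ n     ∎))
    where
      open ℕ.≤-Reasoning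
      instance
        q^n≢0 : ℕ.NonZero (q ℕ.^ n)
        q^n≢0 = ℕ.m^n≢0 q n {{ℕ.>-nonZero (ℕ.<-trans (s≤s z≤n) 1<q)}}

module QuadraticExtension {c ℓ} (F : FiniteField c ℓ)
                          {r} (r-prime : Prime r) (r·1#≈0# : CharacteristicDivides F r)
                          {Q m} (Q≡r^m : Q ≡ r ℕ.^ m)
                          (ξ : FiniteField.Carrier F) (basis : IsBasis1ξ F Q ξ) where
  open FieldProperties F
  open import Relation.Binary.Reasoning.Setoid setoid

  module σ = FrobeniusEndomorphism F r-prime r·1#≈0# {m = m} Q≡r^m

  σ : Carrier → Carrier
  σ = σ.φ

  K : Pred Carrier ℓ
  K = InSubfield F Q

  K? : Decidable K
  K? a = σ a ≟ a

  K-resp : ∀ {x y} → x ≈ y → x ∈ K → y ∈ K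
  K-resp x≈y x∈K = trans (σ.cong (sym x≈y)) (trans x∈K x≈y)

  K-0# : 0# ∈ K
  K-0# = σ.0#-homo

  K-1# : 1# ∈ K
  K-1# = σ.1#-homo

  K-+ : ∀ {a b} → a ∈ K → b ∈ K → a + b ∈ K
  K-+ a∈K b∈K = trans (σ.+-homo _ _) (+-cong a∈K b∈K)

  K-* : ∀ {a b} → a ∈ K → b ∈ K → a * b ∈ K
  K-* a∈K b∈K = trans (σ.*-homo _ _) (*-cong a∈K b∈K)

  K-‿ : ∀ {a} → a ∈ K → - a ∈ K
  K-‿ a∈K = trans (σ.-‿homo _) (-‿cong a∈K)

  K-⁻¹ : ∀ {a} → a ≉ 0# → a ∈ K → a ⁻¹ ∈ K
  K-⁻¹ a≉0 a∈K = trans (σ.⁻¹-homo a≉0) (sym (⁻¹-unique (σ.≉0-homo a≉0) (trans (*-congʳ a∈K) (inverseʳ _ a≉0))))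

  coordinates : ∀ z → Σ Carrier λ a → Σ Carrier λ b → a ∈ K × b ∈ K × z ≈ a + b * ξ
  coordinates = proj₁ basis

  coordinates-unique : ∀ a b → a ∈ K → b ∈ K → a + b * ξ ≈ 0# → a ≈ 0# × b ≈ 0#
  coordinates-unique = proj₂ basis

  ξ≉0 : ξ ≉ 0#
  ξ≉0 ξ≈0 = 1≉0 (proj₂ (coordinates-unique 0# 1# K-0# K-1# (trans (+-identityˡ _) (trans (*-identityˡ _) ξ≈0))))

  ξ∉K : ξ ∉ K
  ξ∉K ξ∈K = 1≉0 (trans (sym (-‿involutive 1#)) (trans (-‿cong -1≈0) -0#≈0#))
    where -1≈0 : - 1# ≈ 0#
          -1≈0 = proj₂ (coordinates-unique ξ (- 1#) ξ∈K (K-‿ K-1#)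
                   (trans (+-congˡ (trans (sym (-‿distribˡ-* 1# ξ)) (-‿cong (*-identityˡ ξ)))) (-‿inverseʳ ξ)))

  -- With ξ² = u + v ξ, both ξ and σ ξ ≠ ξ are roots of X² − v X − u, whose roots sum to v.
  σξ≈v-ξ : ∃ λ v → v ∈ K × σ ξ ≈ v - ξ
  σξ≈v-ξ with coordinates (ξ * ξ)
  ... | u , v , u∈K , v∈K , ξ²≈u+vξ = v , v∈K , conjugate-root (x*y≈0⇒x≈0⊎y≈0 product≈0)
    where
      σξ²≈u+vσξ : σ ξ * σ ξ ≈ u + v * σ ξ
      σξ²≈u+vσξ = begin
        σ ξ * σ ξ         ≈⟨ σ.*-homo ξ ξ ⟨
        σ (ξ * ξ)         ≈⟨ σ.cong ξ²≈u+vξ ⟩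
        σ (u + v * ξ)     ≈⟨ trans (σ.+-homo _ _) (+-cong u∈K (trans (σ.*-homo v ξ) (*-congʳ v∈K))) ⟩
        u + v * σ ξ       ∎
      product≈0 : (σ ξ - ξ) * (σ ξ - (v - ξ)) ≈ 0#
      product≈0 = begin
        (σ ξ - ξ) * (σ ξ - (v - ξ))
          ≈⟨ solve 4 (λ X ξ u v → (X :- ξ) :* (X :- (v :- ξ)) := (X :* X :- (u :+ v :* X)) :- (ξ :* ξ :- (u :+ v :* ξ)))
                     refl (σ ξ) ξ u v ⟩
        (σ ξ * σ ξ - (u + v * σ ξ)) - (ξ * ξ - (u + v * ξ))
          ≈⟨ +-cong (x≈y⇒x-y≈0 σξ²≈u+vσξ) (-‿cong (x≈y⇒x-y≈0 ξ²≈u+vξ)) ⟩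
        0# - 0#
          ≈⟨ -‿inverseʳ 0# ⟩
        0# ∎
      conjugate-root : σ ξ - ξ ≈ 0# ⊎ σ ξ - (v - ξ) ≈ 0# → σ ξ ≈ v - ξ
      conjugate-root (inj₁ σξ-ξ≈0) = contradiction (x-y≈0⇒x≈y σξ-ξ≈0) ξ∉K
      conjugate-root (inj₂ σξ≈v-ξ) = x-y≈0⇒x≈y σξ≈v-ξ

  σσ≈id : ∀ x → σ (σ x) ≈ x
  σσ≈id x with coordinates x | σξ≈v-ξ
  ... | a , b , a∈K , b∈K , x≈a+bξ | v , v∈K , σξ≈v-ξ = begin
    σ (σ x)                ≈⟨ σ.cong (trans (σ.cong x≈a+bξ) (σ-coordinates ξ)) ⟩
    σ (a + b * σ ξ)        ≈⟨ σ-coordinates (σ ξ) ⟩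
    a + b * σ (σ ξ)        ≈⟨ +-congˡ (*-congˡ σσξ≈ξ) ⟩
    a + b * ξ              ≈⟨ x≈a+bξ ⟨
    x                      ∎
    where
      σ-coordinates : ∀ y → σ (a + b * y) ≈ a + b * σ y
      σ-coordinates y = trans (σ.+-homo _ _) (+-cong a∈K (trans (σ.*-homo b y) (*-congʳ b∈K)))
      σσξ≈ξ : σ (σ ξ) ≈ ξ
      σσξ≈ξ = begin
        σ (σ ξ)          ≈⟨ σ.cong σξ≈v-ξ ⟩
        σ (v - ξ)        ≈⟨ σ.minus-homo v ξ ⟩
        σ v - σ ξ        ≈⟨ +-cong v∈K (-‿cong σξ≈v-ξ) ⟩
        v - (v - ξ)      ≈⟨ solve 2 (λ v ξ → v :- (v :- ξ) := ξ) refl v ξ ⟩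
        ξ                ∎

  K-trace : ∀ x → x + σ x ∈ K
  K-trace x = trans (σ.+-homo _ _) (trans (+-congˡ (σσ≈id x)) (+-comm _ _))

  ε : Carrier
  ε = ξ ⁻¹

  ε≉0 : ε ≉ 0#
  ε≉0 = ⁻¹-≉0 ξ≉0

  ε∉K : ε ∉ K
  ε∉K ε∈K = ξ∉K (K-resp (sym ξ≈ε⁻¹) (K-⁻¹ ε≉0 ε∈K))
    where ξ≈ε⁻¹ : ξ ≈ ε ⁻¹
          ξ≈ε⁻¹ = ⁻¹-unique ε≉0 (trans (*-comm _ _) (inverseʳ ξ ξ≉0))

  σ-anti-⁻¹ : ∀ {z} → z ≉ 0# → σ z ≈ - z → σ (z ⁻¹) ≈ - (z ⁻¹)
  σ-anti-⁻¹ {z} z≉0 σz≈-z = begin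
    σ (z ⁻¹)          ≈⟨ -‿involutive _ ⟨
    - (- σ (z ⁻¹))    ≈⟨ -‿cong (⁻¹-unique z≉0 (begin
      z * - σ (z ⁻¹)       ≈⟨ solve 2 (λ z w → z :* (:- w) := (:- z) :* w) refl z (σ (z ⁻¹)) ⟩
      - z * σ (z ⁻¹)       ≈⟨ *-congʳ σz≈-z ⟨
      σ z * σ (z ⁻¹)       ≈⟨ σ.*-homo z (z ⁻¹) ⟨
      σ (z * z ⁻¹)         ≈⟨ σ.cong (inverseʳ z z≉0) ⟩
      σ 1#                 ≈⟨ σ.1#-homo ⟩
      1#                   ∎)) ⟩
    - (z ⁻¹)          ∎

  δ : Carrier
  δ = σ ε - ε

  δ≉0 : δ ≉ 0#
  δ≉0 δ≈0 = ε∉K (x-y≈0⇒x≈y δ≈0)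

  σδ≈-δ : σ δ ≈ - δ
  σδ≈-δ = trans (σ.minus-homo _ ε) (trans (+-congʳ (σσ≈id ε)) (solve 2 (λ a b → b :- a := :- (a :- b)) refl (σ ε) ε))

  x*[δδ⁻¹]≈x : ∀ x → x * (δ * δ ⁻¹) ≈ x
  x*[δδ⁻¹]≈x x = trans (*-congˡ (inverseʳ δ δ≉0)) (*-identityʳ x)

  σδ⁻¹≈-δ⁻¹ : σ (δ ⁻¹) ≈ - (δ ⁻¹)
  σδ⁻¹≈-δ⁻¹ = σ-anti-⁻¹ δ≉0 σδ≈-δ

  -- Solving x = a + b ε, σ x = a + b σ ε for the K-coordinates a, b of x.
  α β : Carrier → Carrier
  α x = (σ ε * x - ε * σ x) * δ ⁻¹
  β x = (σ x - x) * δ ⁻¹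

  x≈αx+βxε : ∀ x → x ≈ α x + β x * ε
  x≈αx+βxε x = sym (begin
    (σ ε * x - ε * σ x) * δ ⁻¹ + (σ x - x) * δ ⁻¹ * ε
      ≈⟨ solve 5 (λ E x ε X d → (E :* x :- ε :* X) :* d :+ (X :- x) :* d :* ε := x :* ((E :- ε) :* d))
                 refl (σ ε) x ε (σ x) (δ ⁻¹) ⟩
    x * (δ * δ ⁻¹)   ≈⟨ x*[δδ⁻¹]≈x x ⟩
    x                ∎)

  α∈K : ∀ x → α x ∈ K
  α∈K x = begin
    σ ((σ ε * x - ε * σ x) * δ ⁻¹)          ≈⟨ σ.*-homo _ _ ⟩
    σ (σ ε * x - ε * σ x) * σ (δ ⁻¹)        ≈⟨ *-cong (trans (σ.minus-homo _ _) (+-cong (trans (σ.*-homo _ _) (*-congʳ (σσ≈id ε)))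
                                                (-‿cong (trans (σ.*-homo _ _) (*-congˡ (σσ≈id x)))))) σδ⁻¹≈-δ⁻¹ ⟩
    (ε * σ x - σ ε * x) * - (δ ⁻¹)          ≈⟨ solve 5 (λ ε X E x d → (ε :* X :- E :* x) :* (:- d) := (E :* x :- ε :* X) :* d)
                                                 refl ε (σ x) (σ ε) x (δ ⁻¹) ⟩
    α x                                     ∎

  β∈K : ∀ x → β x ∈ K
  β∈K x = begin
    σ ((σ x - x) * δ ⁻¹)          ≈⟨ σ.*-homo _ _ ⟩
    σ (σ x - x) * σ (δ ⁻¹)        ≈⟨ *-cong (trans (σ.minus-homo _ _) (+-congʳ (σσ≈id x))) σδ⁻¹≈-δ⁻¹ ⟩
    (x - σ x) * - (δ ⁻¹)          ≈⟨ solve 3 (λ x X d → (x :- X) :* (:- d) := (X :- x) :* d) refl x (σ x) (δ ⁻¹) ⟩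
    β x                           ∎

  K-coordinates-unique : ∀ {a b} → a ∈ K → b ∈ K → a + b * ε ≈ 0# → a ≈ 0# × b ≈ 0#
  K-coordinates-unique {a} {b} a∈K b∈K a+bε≈0 = a≈0 , b≈0
    where
      a+bσε≈0 : a + b * σ ε ≈ 0#
      a+bσε≈0 = trans (sym (+-cong a∈K (trans (σ.*-homo b ε) (*-congʳ b∈K))))
                      (trans (sym (σ.+-homo _ _)) (trans (σ.cong a+bε≈0) σ.0#-homo))
      bδ≈0 : b * δ ≈ 0#
      bδ≈0 = trans (solve 4 (λ a b E ε → b :* (E :- ε) := (a :+ b :* E) :- (a :+ b :* ε)) refl a b (σ ε) ε)
                   (trans (+-cong a+bσε≈0 (-‿cong a+bε≈0)) (-‿inverseʳ 0#))
      b≈0 : b ≈ 0#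
      b≈0 = x*y≈0∧y≉0⇒x≈0 bδ≈0 δ≉0
      a≈0 : a ≈ 0#
      a≈0 = trans (solve 3 (λ a b ε → a := (a :+ b :* ε) :- b :* ε) refl a b ε)
                  (trans (+-cong a+bε≈0 (-‿cong (trans (*-congʳ b≈0) (zeroˡ ε)))) (-‿inverseʳ 0#))

  βx≈0⇒x∈K : ∀ {x} → β x ≈ 0# → x ∈ K
  βx≈0⇒x∈K βx≈0 = x-y≈0⇒x≈y (x*y≈0∧y≉0⇒x≈0 βx≈0 (⁻¹-≉0 δ≉0))

  x∈K⇒βx≈0 : ∀ {x} → x ∈ K → β x ≈ 0#
  x∈K⇒βx≈0 x∈K = trans (*-congʳ (x≈y⇒x-y≈0 x∈K)) (zeroˡ _)

  x∈K⇒αx≈x : ∀ {x} → x ∈ K → α x ≈ x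
  x∈K⇒αx≈x {x} x∈K = begin
    (σ ε * x - ε * σ x) * δ ⁻¹    ≈⟨ *-congʳ (+-congˡ (-‿cong (*-congˡ x∈K))) ⟩
    (σ ε * x - ε * x) * δ ⁻¹      ≈⟨ solve 4 (λ E x ε d → (E :* x :- ε :* x) :* d := x :* ((E :- ε) :* d)) refl (σ ε) x ε (δ ⁻¹) ⟩
    x * (δ * δ ⁻¹)                ≈⟨ x*[δδ⁻¹]≈x x ⟩
    x                             ∎

module LinearSet {c ℓ} (F : FiniteField c ℓ)
                 {r} (r-prime : Prime r) (r·1#≈0# : CharacteristicDivides F r)
                 {q k} (q≡r^k : q ≡ r ℕ.^ k) (t s : ℕ)
                 (ξ : FiniteField.Carrier F) (basis : IsBasis1ξ F (q ℕ.^ t) ξ) where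
  open FieldProperties F
  open import Relation.Binary.Reasoning.Setoid setoid
  open QuadraticExtension F r-prime r·1#≈0# {m = k ℕ.* t} (q≡r^k⇒q^n≡r^[k*n] {r = r} {k} q≡r^k t) ξ basis public
  open AdditiveMaps F

  module τ = FrobeniusEndomorphism F r-prime r·1#≈0# {m = k ℕ.* s} (q≡r^k⇒q^n≡r^[k*n] {r = r} {k} q≡r^k s)

  τ : Carrier → Carrier
  τ = τ.φ

  p : Carrier → Carrier
  p = pPoly F (q ℕ.^ t) (q ℕ.^ s) ε

  στ≈τσ : ∀ x → σ (τ x) ≈ τ (σ x)
  στ≈τσ x = ^-comm x (q ℕ.^ s) (q ℕ.^ t)

  K-τ : ∀ {a} → a ∈ K → τ a ∈ K
  K-τ {a} a∈K = trans (στ≈τσ a) (τ.cong a∈K)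

  τδ⁻¹≈[τσε-τε]⁻¹ : τ (δ ⁻¹) ≈ (τ (σ ε) - τ ε) ⁻¹
  τδ⁻¹≈[τσε-τε]⁻¹ = ⁻¹-unique τσε-τε≉0 (begin
    (τ (σ ε) - τ ε) * τ (δ ⁻¹)     ≈⟨ *-congʳ (τ.minus-homo (σ ε) ε) ⟨
    τ δ * τ (δ ⁻¹)                 ≈⟨ τ.*-homo δ (δ ⁻¹) ⟨
    τ (δ * δ ⁻¹)                   ≈⟨ τ.cong (inverseʳ δ δ≉0) ⟩
    τ 1#                           ≈⟨ τ.1#-homo ⟩
    1#                             ∎)
    where τσε-τε≉0 : τ (σ ε) - τ ε ≉ 0#
          τσε-τε≉0 τσε-τε≈0 = τ.≉0-homo δ≉0 (trans (τ.minus-homo (σ ε) ε) τσε-τε≈0)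

  -- p x unfolds to w x + σ (w x).
  w : Carrier → Carrier
  w x = (σ ε * δ ⁻¹) * x + (1# * (τ (σ ε) - τ ε) ⁻¹) * τ x

  w-cong : ∀ {x y} → x ≈ y → w x ≈ w y
  w-cong x≈y = +-cong (*-congˡ x≈y) (*-congˡ (τ.cong x≈y))

  w-+-homo : ∀ x y → w (x + y) ≈ w x + w y
  w-+-homo x y = trans (+-cong (distribˡ _ x y) (trans (*-congˡ (τ.+-homo x y)) (distribˡ _ _ _)))
                       (solve 4 (λ a b c d → (a :+ b) :+ (c :+ d) := (a :+ c) :+ (b :+ d)) refl _ _ _ _)

  p-additive : IsAdditive p
  p-additive = record
    { cong   = λ x≈y → +-cong (w-cong x≈y) (σ.cong (w-cong x≈y))
    ; +-homo = λ x y → trans (+-cong (w-+-homo x y) (trans (σ.cong (w-+-homo x y)) (σ.+-homo _ _)))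
        (solve 4 (λ a b c d → (a :+ b) :+ (c :+ d) := (a :+ c) :+ (b :+ d)) refl (w x) (w y) (σ (w x)) (σ (w y)))
    }

  w-normal-form : ∀ x → w x ≈ (σ ε * δ ⁻¹) * x + τ (δ ⁻¹) * τ x
  w-normal-form x = +-congˡ (*-congʳ (trans (*-identityˡ _) (sym τδ⁻¹≈[τσε-τε]⁻¹)))

  σ[τδ⁻¹]≈-τδ⁻¹ : σ (τ (δ ⁻¹)) ≈ - τ (δ ⁻¹)
  σ[τδ⁻¹]≈-τδ⁻¹ = trans (στ≈τσ (δ ⁻¹)) (trans (τ.cong σδ⁻¹≈-δ⁻¹) (τ.-‿homo (δ ⁻¹)))

  σ∘w-normal-form : ∀ x → σ (w x) ≈ (ε * - δ ⁻¹) * σ x + (- τ (δ ⁻¹)) * τ (σ x)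
  σ∘w-normal-form x = begin
    σ (w x)                                                 ≈⟨ σ.cong (w-normal-form x) ⟩
    σ ((σ ε * δ ⁻¹) * x + τ (δ ⁻¹) * τ x)                   ≈⟨ σ.+-homo _ _ ⟩
    σ ((σ ε * δ ⁻¹) * x) + σ (τ (δ ⁻¹) * τ x)               ≈⟨ +-cong (σ.*-homo _ x) (σ.*-homo _ _) ⟩
    σ (σ ε * δ ⁻¹) * σ x + σ (τ (δ ⁻¹)) * σ (τ x)           ≈⟨ +-cong (*-congʳ (trans (σ.*-homo _ _) (*-cong (σσ≈id ε) σδ⁻¹≈-δ⁻¹)))
                                                                      (*-cong σ[τδ⁻¹]≈-τδ⁻¹ (στ≈τσ x)) ⟩
    (ε * - δ ⁻¹) * σ x + (- τ (δ ⁻¹)) * τ (σ x)             ∎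

  p≈α-τβ : ∀ x → p x ≈ α x - τ (β x)
  p≈α-τβ x = begin
    w x + σ (w x)
      ≈⟨ +-cong (w-normal-form x) (σ∘w-normal-form x) ⟩
    ((σ ε * δ ⁻¹) * x + τ (δ ⁻¹) * τ x) + ((ε * - δ ⁻¹) * σ x + (- τ (δ ⁻¹)) * τ (σ x))
      ≈⟨ solve 8 (λ E d x e X D Y Z → ((E :* d) :* x :+ D :* X) :+ ((e :* (:- d)) :* Y :+ (:- D) :* Z)
                                       := (E :* x :- e :* Y) :* d :- (Z :- X) :* D)
                 refl (σ ε) (δ ⁻¹) x ε (τ x) (τ (δ ⁻¹)) (σ x) (τ (σ x)) ⟩
    α x - (τ (σ x) - τ x) * τ (δ ⁻¹)
      ≈⟨ +-congˡ (-‿cong (trans (τ.*-homo _ _) (*-congʳ (τ.minus-homo (σ x) x)))) ⟨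
    α x - τ (β x) ∎

  p∈K : ∀ x → p x ∈ K
  p∈K x = K-trace (w x)

  x∈K⇒px≈x : ∀ {x} → x ∈ K → p x ≈ x
  x∈K⇒px≈x {x} x∈K = begin
    p x                ≈⟨ p≈α-τβ x ⟩
    α x - τ (β x)      ≈⟨ +-cong (x∈K⇒αx≈x x∈K) (-‿cong (trans (τ.cong (x∈K⇒βx≈0 x∈K)) τ.0#-homo)) ⟩
    x - 0#             ≈⟨ trans (+-congˡ -0#≈0#) (+-identityʳ x) ⟩
    x                  ∎

  px≈x⇒x∈K : ∀ {x} → p x ≈ x → x ∈ K
  px≈x⇒x∈K {x} px≈x = βx≈0⇒x∈K (proj₂ (K-coordinates-unique (K-τ (β∈K x)) (β∈K x) (begin
    τ (β x) + β x * ε                  ≈⟨ solve 3 (λ a b c → c :+ b := (a :+ b) :- (a :- c)) refl (α x) (β x * ε) (τ (β x)) ⟩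
    (α x + β x * ε) - (α x - τ (β x))  ≈⟨ +-cong (x≈αx+βxε x) (-‿cong (p≈α-τβ x)) ⟨
    x - p x                            ≈⟨ x≈y⇒x-y≈0 (sym px≈x) ⟩
    0#                                 ∎)))

  1+ε : Carrier
  1+ε = 1# + ε

  p[1+ε]≈0 : p 1+ε ≈ 0#
  p[1+ε]≈0 = begin
    p 1+ε                ≈⟨ p≈α-τβ 1+ε ⟩
    α 1+ε - τ (β 1+ε)    ≈⟨ +-cong α[1+ε]≈1 (-‿cong (trans (τ.cong β[1+ε]≈1) τ.1#-homo)) ⟩
    1# - 1#              ≈⟨ -‿inverseʳ 1# ⟩
    0#                   ∎
    where
      σ[1+ε]≈1+σε : σ 1+ε ≈ 1# + σ ε
      σ[1+ε]≈1+σε = trans (σ.+-homo 1# ε) (+-congʳ σ.1#-homo)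
      α[1+ε]≈1 : α 1+ε ≈ 1#
      α[1+ε]≈1 = begin
        (σ ε * 1+ε - ε * σ 1+ε) * δ ⁻¹             ≈⟨ *-congʳ (+-congˡ (-‿cong (*-congˡ σ[1+ε]≈1+σε))) ⟩
        (σ ε * (1# + ε) - ε * (1# + σ ε)) * δ ⁻¹   ≈⟨ *-congʳ (solve 2 (λ E ε → E :* (:1# :+ ε) :- ε :* (:1# :+ E) := E :- ε) refl (σ ε) ε) ⟩
        δ * δ ⁻¹                                   ≈⟨ inverseʳ δ δ≉0 ⟩
        1#                                         ∎
      β[1+ε]≈1 : β 1+ε ≈ 1#
      β[1+ε]≈1 = begin
        (σ 1+ε - 1+ε) * δ ⁻¹              ≈⟨ *-congʳ (+-congʳ σ[1+ε]≈1+σε) ⟩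
        ((1# + σ ε) - (1# + ε)) * δ ⁻¹    ≈⟨ *-congʳ (solve 2 (λ E ε → (:1# :+ E) :- (:1# :+ ε) := E :- ε) refl (σ ε) ε) ⟩
        δ * δ ⁻¹                          ≈⟨ inverseʳ δ δ≉0 ⟩
        1#                                ∎

  1+ε≉0 : 1+ε ≉ 0#
  1+ε≉0 1+ε≈0 = ε∉K (K-resp (sym ε≈-1) (K-‿ K-1#))
    where ε≈-1 : ε ≈ - 1#
          ε≈-1 = trans (solve 1 (λ ε → ε := (:1# :+ ε) :- :1#) refl ε) (trans (+-congʳ 1+ε≈0) (+-identityˡ _))

  p-linear : ∀ {μ} → μ ^ q ≈ μ → ∀ x → p (μ * x) ≈ μ * p x
  p-linear {μ} μ^q≈μ x = begin
    p (μ * x)                        ≈⟨ p≈α-τβ (μ * x) ⟩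
    α (μ * x) - τ (β (μ * x))        ≈⟨ +-cong α[μx]≈μαx (-‿cong (trans (τ.cong β[μx]≈μβx) (trans (τ.*-homo μ (β x)) (*-congʳ τμ≈μ)))) ⟩
    μ * α x - μ * τ (β x)            ≈⟨ solve 3 (λ μ a b → μ :* a :- μ :* b := μ :* (a :- b)) refl μ (α x) (τ (β x)) ⟩
    μ * (α x - τ (β x))              ≈⟨ *-congˡ (p≈α-τβ x) ⟨
    μ * p x                          ∎
    where
      σμ≈μ : σ μ ≈ μ
      σμ≈μ = ^-fixed-iterate q μ^q≈μ t
      τμ≈μ : τ μ ≈ μ
      τμ≈μ = ^-fixed-iterate q μ^q≈μ s
      σ[μx]≈μσx : σ (μ * x) ≈ μ * σ x
      σ[μx]≈μσx = trans (σ.*-homo μ x) (*-congʳ σμ≈μ)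
      α[μx]≈μαx : α (μ * x) ≈ μ * α x
      α[μx]≈μαx = trans (*-congʳ (+-congˡ (-‿cong (*-congˡ σ[μx]≈μσx))))
        (solve 6 (λ E μ x e X d → (E :* (μ :* x) :- e :* (μ :* X)) :* d := μ :* ((E :* x :- e :* X) :* d)) refl (σ ε) μ x ε (σ x) (δ ⁻¹))
      β[μx]≈μβx : β (μ * x) ≈ μ * β x
      β[μx]≈μβx = trans (*-congʳ (+-congʳ σ[μx]≈μσx))
        (solve 4 (λ μ X x d → (μ :* X :- μ :* x) :* d := μ :* ((X :- x) :* d)) refl μ (σ x) x (δ ⁻¹))

  ratio-fixed⇒samePoint : ∀ {x y} → x ≉ 0# → (y * x ⁻¹) ^ q ≈ y * x ⁻¹ → SamePoint F p x y
  ratio-fixed⇒samePoint {x} {y} x≉0 μ^q≈μ = begin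
    x * p y                ≈⟨ *-congˡ (IsAdditive.cong p-additive y≈μx) ⟩
    x * p (μ * x)          ≈⟨ *-congˡ (p-linear μ^q≈μ x) ⟩
    x * (μ * p x)          ≈⟨ solve 3 (λ x μ P → x :* (μ :* P) := (μ :* x) :* P) refl x μ (p x) ⟩
    (μ * x) * p x          ≈⟨ *-congʳ y≈μx ⟨
    y * p x                ∎
    where
      μ = y * x ⁻¹
      y≈μx : y ≈ μ * x
      y≈μx = sym (x*y⁻¹*y≈x x≉0 y)

  -- Ring identities used below are stated over variables: running the solver directly on
  -- the unfolded α x, β x, τ (β x), … exhausts memory.
  cross-product-expansion : ∀ a₁ b₁ a₂ b₂ u₁ u₂ e →
           (a₂ * u₁ - a₁ * u₂) + (b₁ * a₂ - b₁ * u₂ - b₂ * a₁ + b₂ * u₁) * e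
             ≈ (a₁ + b₁ * e) * (a₂ - u₂) - (a₂ + b₂ * e) * (a₁ - u₁)
  cross-product-expansion = solve 7 (λ a₁ b₁ a₂ b₂ u₁ u₂ e → (a₂ :* u₁ :- a₁ :* u₂) :+ (b₁ :* a₂ :- b₁ :* u₂ :- b₂ :* a₁ :+ b₂ :* u₁) :* e
                                             := (a₁ :+ b₁ :* e) :* (a₂ :- u₂) :- (a₂ :+ b₂ :* e) :* (a₁ :- u₁)) refl

  factorisation : ∀ b a u m v → b * ((u - m) * (a - v)) ≈ b * (a * u) - b * (u * v) - (m * b) * a + (m * b) * v
  factorisation = solve 5 (λ b a u m v → b :* ((u :- m) :* (a :- v)) := b :* (a :* u) :- b :* (u :* v) :- (m :* b) :* a :+ (m :* b) :* v) refl

  scale-coordinates : ∀ a m b e → a * m + m * b * e ≈ m * (a + b * e)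
  scale-coordinates = solve 4 (λ a m b e → a :* m :+ m :* b :* e := m :* (a :+ b :* e)) refl

  -- The two K-coordinates of x p(y) − y p(x), for x = a₁ + b₁ ε and y = a₂ + b₂ ε.
  samePoint⇒K-equations : ∀ {x y} → SamePoint F p x y →
    let a₁ = α x; b₁ = β x; a₂ = α y; b₂ = β y in
    a₂ * τ b₁ ≈ a₁ * τ b₂ × b₁ * a₂ - b₁ * τ b₂ - b₂ * a₁ + b₂ * τ b₁ ≈ 0#
  samePoint⇒K-equations {x} {y} x*py≈y*px =
    x-y≈0⇒x≈y (proj₁ components≈0) , proj₂ components≈0
    where
      a₁ = α x; b₁ = β x; a₂ = α y; b₂ = β y
      K-A : a₂ * τ b₁ - a₁ * τ b₂ ∈ K
      K-A = K-+ (K-* (α∈K y) (K-τ (β∈K x))) (K-‿ (K-* (α∈K x) (K-τ (β∈K y))))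
      K-B : b₁ * a₂ - b₁ * τ b₂ - b₂ * a₁ + b₂ * τ b₁ ∈ K
      K-B = K-+ (K-+ (K-+ (K-* (β∈K x) (α∈K y)) (K-‿ (K-* (β∈K x) (K-τ (β∈K y)))))
                     (K-‿ (K-* (β∈K y) (α∈K x)))) (K-* (β∈K y) (K-τ (β∈K x)))
      components≈0 : a₂ * τ b₁ - a₁ * τ b₂ ≈ 0# × b₁ * a₂ - b₁ * τ b₂ - b₂ * a₁ + b₂ * τ b₁ ≈ 0#
      components≈0 = K-coordinates-unique K-A K-B (begin
        (a₂ * τ b₁ - a₁ * τ b₂) + (b₁ * a₂ - b₁ * τ b₂ - b₂ * a₁ + b₂ * τ b₁) * ε
          ≈⟨ cross-product-expansion a₁ b₁ a₂ b₂ (τ b₁) (τ b₂) ε ⟩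
        (a₁ + b₁ * ε) * (a₂ - τ b₂) - (a₂ + b₂ * ε) * (a₁ - τ b₁)
          ≈⟨ +-cong (*-cong (x≈αx+βxε x) (p≈α-τβ y)) (-‿cong (*-cong (x≈αx+βxε y) (p≈α-τβ x))) ⟨
        x * p y - y * p x
          ≈⟨ x≈y⇒x-y≈0 x*py≈y*px ⟩
        0# ∎)

  samePoint⇒proportional : ∀ {x y} → β x ≉ 0# → p x ≉ 0# → SamePoint F p x y →
                           ∃ λ μ → μ ∈ K × τ μ ≈ μ × y ≈ μ * x
  samePoint⇒proportional {x} {y} b₁≉0 px≉0 x*py≈y*px = μ , μ∈K , τμ≈μ , y≈μx
    where
      a₁ = α x; b₁ = β x; a₂ = α y; b₂ = β y
      equations : a₂ * τ b₁ ≈ a₁ * τ b₂ × b₁ * a₂ - b₁ * τ b₂ - b₂ * a₁ + b₂ * τ b₁ ≈ 0#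
      equations = samePoint⇒K-equations x*py≈y*px
      μ = b₂ * b₁ ⁻¹
      μ∈K : μ ∈ K
      μ∈K = K-* (β∈K y) (K-⁻¹ b₁≉0 (β∈K x))
      b₂≈μb₁ : b₂ ≈ μ * b₁
      b₂≈μb₁ = sym (x*y⁻¹*y≈x b₁≉0 b₂)
      τb₂≈τμτb₁ : τ b₂ ≈ τ μ * τ b₁
      τb₂≈τμτb₁ = trans (τ.cong b₂≈μb₁) (τ.*-homo μ b₁)
      a₂≈a₁τμ : a₂ ≈ a₁ * τ μ
      a₂≈a₁τμ = *-cancelˡ (τ.≉0-homo b₁≉0) (begin
        τ b₁ * a₂              ≈⟨ *-comm _ _ ⟩
        a₂ * τ b₁              ≈⟨ proj₁ equations ⟩
        a₁ * τ b₂              ≈⟨ *-congˡ τb₂≈τμτb₁ ⟩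
        a₁ * (τ μ * τ b₁)      ≈⟨ solve 3 (λ a m b → a :* (m :* b) := b :* (a :* m)) refl a₁ (τ μ) (τ b₁) ⟩
        τ b₁ * (a₁ * τ μ)      ∎)
      b₁[τμ-μ][a₁-τb₁]≈0 : b₁ * ((τ μ - μ) * (a₁ - τ b₁)) ≈ 0#
      b₁[τμ-μ][a₁-τb₁]≈0 = begin
        b₁ * ((τ μ - μ) * (a₁ - τ b₁))
          ≈⟨ factorisation b₁ a₁ (τ μ) μ (τ b₁) ⟩
        b₁ * (a₁ * τ μ) - b₁ * (τ μ * τ b₁) - (μ * b₁) * a₁ + (μ * b₁) * τ b₁
          ≈⟨ +-cong (+-cong (+-cong (*-congˡ a₂≈a₁τμ) (-‿cong (*-congˡ τb₂≈τμτb₁))) (-‿cong (*-congʳ b₂≈μb₁))) (*-congʳ b₂≈μb₁) ⟨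
        b₁ * a₂ - b₁ * τ b₂ - b₂ * a₁ + b₂ * τ b₁
          ≈⟨ proj₂ equations ⟩
        0# ∎
      τμ≈μ : τ μ ≈ μ
      τμ≈μ = x-y≈0⇒x≈y (x*y≈0∧y≉0⇒x≈0 (x*y≈0∧x≉0⇒y≈0 b₁[τμ-μ][a₁-τb₁]≈0 b₁≉0) (px≉0 ∘ trans (p≈α-τβ x)))
      y≈μx : y ≈ μ * x
      y≈μx = begin
        y                      ≈⟨ x≈αx+βxε y ⟩
        a₂ + b₂ * ε            ≈⟨ +-cong (trans a₂≈a₁τμ (*-congˡ τμ≈μ)) (*-congʳ b₂≈μb₁) ⟩
        a₁ * μ + μ * b₁ * ε    ≈⟨ scale-coordinates a₁ μ b₁ ε ⟩
        μ * (a₁ + b₁ * ε)      ≈⟨ *-congˡ (x≈αx+βxε x) ⟨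
        μ * x                  ∎

  proportional⇒ratio-fixed : ∀ {x y} → gcd s t ≡ 1 → x ≉ 0# →
                             (∃ λ μ → μ ∈ K × τ μ ≈ μ × y ≈ μ * x) → (y * x ⁻¹) ^ q ≈ y * x ⁻¹
  proportional⇒ratio-fixed {x} {y} gcd[s,t]≡1 x≉0 (μ , μ∈K , τμ≈μ , y≈μx) =
    trans (^-cong q y/x≈μ) (trans (^-fixed-gcd q {s} {t} gcd[s,t]≡1 τμ≈μ μ∈K) (sym y/x≈μ))
    where
      y/x≈μ : y * x ⁻¹ ≈ μ
      y/x≈μ = trans (*-congʳ y≈μx) (x*y*y⁻¹≈x x≉0 μ)

  samePoint⇒ratio-fixed : ∀ {x y} → gcd s t ≡ 1 → x ≉ 0# → p x ≉ x → p x ≉ 0# →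
                          SamePoint F p x y → (y * x ⁻¹) ^ q ≈ y * x ⁻¹
  samePoint⇒ratio-fixed gcd[s,t]≡1 x≉0 px≉x px≉0 x*py≈y*px = proportional⇒ratio-fixed gcd[s,t]≡1 x≉0
    (samePoint⇒proportional (px≉x ∘ x∈K⇒px≈x ∘ βx≈0⇒x∈K) px≉0 x*py≈y*px)

module Weights {c ℓ} (F : FiniteField c ℓ)
               {r q k} (r-prime : Prime r) (q≡r^k : q ≡ r ℕ.^ k) (k≥1 : k ≥ 1)
               (t s : ℕ) (t≥1 : t ≥ 1) (gcd[s,t]≡1 : gcd s t ≡ 1)
               (size≡q^[2t] : FiniteField.size F ≡ q ℕ.^ (2 ℕ.* t))
               (ξ : FiniteField.Carrier F) (basis : IsBasis1ξ F (q ℕ.^ t) ξ) where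
  open FieldProperties F

  r·1#≈0# : CharacteristicDivides F r
  r·1#≈0# = Characteristic.size≡r^m⇒r·1#≈0# F {r} {k ℕ.* (2 ℕ.* t)} (≡.trans size≡q^[2t] (q≡r^k⇒q^n≡r^[k*n] {r = r} {k} q≡r^k (2 ℕ.* t)))

  open LinearSet F r-prime r·1#≈0# {k = k} q≡r^k t s ξ basis public
  open FieldCounting F
  open AdditiveMaps F

  Q : ℕ
  Q = q ℕ.^ t

  1<q : 1 < q
  1<q = ≡.subst (1 <_) (≡.sym q≡r^k) (ℕ.^-monoʳ-< r (ℕ.nonTrivial⇒n>1 r {{prime⇒nonTrivial r-prime}}) k≥1)

  1<Q : 1 < Q
  1<Q = ℕ.^-monoʳ-< q 1<q {0} {t} t≥1

  q^[2t]≡Q*Q : q ℕ.^ (2 ℕ.* t) ≡ Q ℕ.* Q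
  q^[2t]≡Q*Q = ≡.trans (≡.cong (λ n → q ℕ.^ (t ℕ.+ n)) (ℕ.+-identityʳ t)) (ℕ.^-distribˡ-+-* q t t)

  z^[Q*Q]≈z : ∀ z → z ^ (Q ℕ.* Q) ≈ z
  z^[Q*Q]≈z z = trans (sym (^-assocʳ z Q Q)) (σσ≈id z)

  #K≡Q : # K? ≡ Q
  #K≡Q = FrobeniusFixedPoints.#fixed≡q F r-prime r·1#≈0# {k = k ℕ.* t} (q≡r^k⇒q^n≡r^[k*n] {r = r} {k} q≡r^k t) 1<Q 1
           (≡.trans size≡q^[2t] (≡.trans q^[2t]≡Q*Q (≡.cong (Q ℕ.*_) (≡.sym (ℕ.*-identityʳ Q)))))
           (λ z → trans (reflexive (≡.cong (z ^_) (≡.cong (Q ℕ.*_) (ℕ.*-identityʳ Q)))) (z^[Q*Q]≈z z))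

  #𝔽q≡q : # (λ z → (z ^ q) ≟ z) ≡ q
  #𝔽q≡q = FrobeniusFixedPoints.#fixed≡q F r-prime r·1#≈0# {k = k} q≡r^k 1<q (ℕ.pred (2 ℕ.* t))
            (≡.trans size≡q^[2t] (≡.cong (q ℕ.^_) (≡.sym 1+pred[2t]≡2t)))
            (λ z → trans (reflexive (≡.cong (z ^_) (≡.trans (≡.cong (q ℕ.^_) 1+pred[2t]≡2t) q^[2t]≡Q*Q))) (z^[Q*Q]≈z z))
    where
      1+pred[2t]≡2t : suc (ℕ.pred (2 ℕ.* t)) ≡ 2 ℕ.* t
      1+pred[2t]≡2t = ℕ.suc-pred (2 ℕ.* t) {{ℕ.>-nonZero (ℕ.*-mono-≤ (s≤s (z≤n {1})) t≥1)}}

  #kernel≡Q : # (λ x → p x ≟ 0#) ≡ Q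
  #kernel≡Q = ℕ.*-cancelʳ-≡ _ Q Q {{ℕ.>-nonZero (ℕ.<-trans (s≤s z≤n) 1<Q)}} (begin
    # (λ x → p x ≟ 0#) ℕ.* Q        ≡⟨ ≡.cong (# (λ x → p x ≟ 0#) ℕ.*_) #K≡Q ⟨
    # (λ x → p x ≟ 0#) ℕ.* # K?     ≡⟨ size≡#kernel*#image p-additive K? K-resp p∈K (λ y y∈K → y , x∈K⇒px≈x y∈K) ⟨
    size                             ≡⟨ ≡.trans size≡q^[2t] q^[2t]≡Q*Q ⟩
    Q ℕ.* Q                          ∎)
    where open ≡.≡-Reasoning

  HasWeight-via : ∀ x w {P : Pred Carrier ℓ₁} (P? : Decidable P) →
                  SamePoint F p x ≐ P → # P? ≡ q ℕ.^ w → HasWeight F p q x w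
  HasWeight-via x w P? samePoint≐P #P≡q^w = ≡.trans (count≡# (λ y → (x * p y) ≟ (y * p x)))
    (≡.trans (#-cong (λ y → (x * p y) ≟ (y * p x)) P? samePoint≐P) #P≡q^w)

  p1≈1 : p 1# ≈ 1#
  p1≈1 = x∈K⇒px≈x K-1#

  y*p1≈y : ∀ y → y * p 1# ≈ y
  y*p1≈y y = trans (*-congˡ p1≈1) (*-identityʳ y)

  y*p[1+ε]≈0 : ∀ y → y * p 1+ε ≈ 0#
  y*p[1+ε]≈0 y = trans (*-congˡ p[1+ε]≈0) (zeroʳ y)

  weight-1 : HasWeight F p q 1# t
  weight-1 = HasWeight-via 1# t K?
    ( (λ {y} 1*py≈y*p1 → px≈x⇒x∈K (trans (sym (*-identityˡ _)) (trans 1*py≈y*p1 (y*p1≈y y))))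
    , (λ {y} y∈K → trans (*-identityˡ _) (trans (x∈K⇒px≈x y∈K) (sym (y*p1≈y y)))))
    #K≡Q

  weight-1+ε : HasWeight F p q 1+ε t
  weight-1+ε = HasWeight-via 1+ε t (λ y → p y ≟ 0#)
    ( (λ {y} [1+ε]py≈yp[1+ε] → x*y≈0∧x≉0⇒y≈0 (trans [1+ε]py≈yp[1+ε] (y*p[1+ε]≈0 y)) 1+ε≉0)
    , (λ {y} py≈0 → trans (trans (*-congˡ py≈0) (zeroʳ 1+ε)) (sym (y*p[1+ε]≈0 y))))
    #kernel≡Q

  1≁1+ε : ¬ SamePoint F p 1# 1+ε
  1≁1+ε 1*p[1+ε]≈[1+ε]*p1 = 1+ε≉0 (trans (sym (y*p1≈y 1+ε)) (trans (sym 1*p[1+ε]≈[1+ε]*p1) (trans (*-identityˡ _) p[1+ε]≈0)))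

  weight-others : ∀ x → x ≉ 0# → ¬ SamePoint F p x 1# → ¬ SamePoint F p x 1+ε → HasWeight F p q x 1
  weight-others x x≉0 x≁1 x≁1+ε = HasWeight-via x 1 (λ y → ((y * x ⁻¹) ^ q) ≟ (y * x ⁻¹))
    (samePoint⇒ratio-fixed gcd[s,t]≡1 x≉0 px≉x px≉0 , ratio-fixed⇒samePoint x≉0)
    (≡.trans (#-scale (λ z → (z ^ q) ≟ z) (λ z≈z′ z^q≈z → trans (^-cong q (sym z≈z′)) (trans z^q≈z z≈z′)) (⁻¹-≉0 x≉0))
             (≡.trans #𝔽q≡q (≡.sym (ℕ.*-identityʳ q))))
    where
      px≉x : p x ≉ x
      px≉x px≈x = x≁1 (trans (y*p1≈y x) (trans (sym px≈x) (sym (*-identityˡ _))))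
      px≉0 : p x ≉ 0#
      px≉0 px≈0 = x≁1+ε (trans (y*p[1+ε]≈0 x) (sym (trans (*-congˡ px≈0) (zeroʳ 1+ε))))

open import Data.Nat using (_^_; _*_)

corollary4p18 : {c ℓ : Level} (q t s : ℕ) → IsPrimePower q → t ≥ 1 → s ≥ 1 → gcd s t ≡ 1 →
    (F : FiniteField c ℓ) → FiniteField.size F ≡ q ^ (2 * t) →
    (ξ : FiniteField.Carrier F) → IsBasis1ξ F (q ^ t) ξ →
    let open FiniteField F
        p = pPoly F (q ^ t) (q ^ s) (ξ ⁻¹)
    in Σ Carrier λ x₁ → Σ Carrier λ x₂ →
         ¬ (x₁ ≈ 0#) × ¬ (x₂ ≈ 0#) × ¬ SamePoint F p x₁ x₂
         × HasWeight F p q x₁ t × HasWeight F p q x₂ t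
         × (∀ x → ¬ (x ≈ 0#) → ¬ SamePoint F p x x₁ → ¬ SamePoint F p x x₂ →
              HasWeight F p q x 1)
corollary4p18 q t s (r , k , r-prime , k≥1 , q≡r^k) t≥1 _ gcd[s,t]≡1 F size≡q^[2t] ξ basis =
  1# , 1+ε , 1≉0 , 1+ε≉0 , 1≁1+ε , weight-1 , weight-1+ε , weight-others
  where
    open FiniteField F using (1#; 1≉0)
    open Weights F r-prime q≡r^k k≥1 t s t≥1 gcd[s,t]≡1 size≡q^[2t] ξ basis
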